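{- For every natural number $m$, the number $d_F(m,m)$ of maximal antichains in $[m]\times[m]$ equals $$1 + 2 \sum_{k=1}^{\lfloor\frac{2m-1}{3}\rfloor} \sum_{t=1}^{k}\binom{m-k-1}{\lfloor t/2\rfloor}\binom{m-k-1}{\lfloor (t-1)/2\rfloor}\binom{2m-k-t}{k-t} + 2 \sum_{k=\lfloor\frac{2m-1}{3}\rfloor +1}^{m-1} \sum_{t=1}^{2m-2k-1}\binom{m-k-1}{\lfloor t/2\rfloor}\binom{m-k-1}{\lfloor (t-1)/2\rfloor}\binom{2m-k-t}{k-t},$$ where empty sums are $0$.
   Context: $[m]=\{1,\dots,m\}$ (with $[0]=\emptyset$). On $[m]\times[m]$, $(x,y)>^*(z,w)$ iff $x\ge z$, $y\ge w$ and at least one inequality is strict. An antichain is a subset whose distinct elements are pairwise $>^*$-incomparable; it is maximal if it is not properly contained in another antichain. -}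

module Defs where

open import Data.Nat using (ℕ; zero; suc; _+_; _*_; _∸_; _/_)
open import Data.Nat.Combinatorics using (_C_)
open import Data.Bool using (Bool; true; false)
open import Data.Fin using (Fin; _≤_; _<_)
open import Data.Vec using (Vec; lookup)
open import Data.List using (List; map; upTo)
open import Data.Nat.ListAction using (sum)
open import Data.Product using (_×_; _,_)
open import Data.Sum using (_⊎_)
open import Relation.Nullary using (¬_)
open import Relation.Binary.PropositionalEquality using (_≡_; _≢_)

-- [m] = {1,…,m} is represented by Fin m = {0,…,m-1} (order-isomorphic via i ↦ i+1).
Point : ℕ → Set
Point m = Fin m × Fin m

-- A subset of [m]×[m], as an m×m Boolean grid (so equality of subsets is ≡).
Grid : ℕ → Set
Grid m = Vec (Vec Bool m) m

_∈G_ : ∀ {m} → Point m → Grid m → Set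
(i , j) ∈G S = lookup (lookup S i) j ≡ true

_⊆G_ : ∀ {m} → Grid m → Grid m → Set
S ⊆G T = ∀ a → a ∈G S → a ∈G T

_>*_ : ∀ {m} → Point m → Point m → Set
(x , y) >* (z , w) = (z ≤ x × w ≤ y) × (z < x ⊎ w < y)

IsAntichain : ∀ {m} → Grid m → Set
IsAntichain S = ∀ a b → a ∈G S → b ∈G S → a ≢ b → ¬ (a >* b) × ¬ (b >* a)

IsMaximalAntichain : ∀ {m} → Grid m → Set
IsMaximalAntichain S = IsAntichain S × (∀ T → IsAntichain T → S ⊆G T → T ⊆G S)

-- Σ_{k=a}^{b} f k  (0 if b < a)
sumRange : ℕ → ℕ → (ℕ → ℕ) → ℕ
sumRange a b f = sum (map (λ i → f (a + i)) (upTo (suc b ∸ a)))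

term : ℕ → ℕ → ℕ → ℕ
term m k t = ((m ∸ k ∸ 1) C (t / 2)) * ((m ∸ k ∸ 1) C ((t ∸ 1) / 2)) * ((2 * m ∸ k ∸ t) C (k ∸ t))

formula : ℕ → ℕ
formula m =
  1 + 2 * sumRange 1 L (λ k → sumRange 1 k (term m k))
    + 2 * sumRange (suc L) (m ∸ 1) (λ k → sumRange 1 (2 * m ∸ 2 * k ∸ 1) (term m k))
  where
  L : ℕ
  L = (2 * m ∸ 1) / 3

-- A maximal antichain in a w × h box is the point set of exactly one staircase path through the
-- box built from unit steps D (a diagonal step carrying a point), E and N in which no E is next to
-- an N: such a corner would leave a free cell that could be added. Peeling off the first column
-- of the box proves this in both directions.
--
-- For w = h = m, a path other than Dᵐ with k steps D has m ∸ k steps E and as many N. Its word of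
-- E and N steps is fixed by its first letter, its t ≥ 1 turns and its runs: the odd runs form a
-- composition of m ∸ k into ⌊t/2⌋ + 1 parts and the even runs one into ⌊(t∸1)/2⌋ + 1 parts. The
-- remaining k ∸ t steps D, beyond the one forced at each turn, are spread over the 2(m ∸ k) + 1 gaps
-- of the word. These choices give the three binomial factors of the summand, and t ranges up to
-- min (k , 2(m ∸ k) ∸ 1), the minimum being k exactly when k ≤ ⌊(2m ∸ 1)/3⌋.

module Submission where

open import Defs
open import Data.Nat using (ℕ; zero; suc; pred; z<s; _<?_; _≤?_; ⌊_/2⌋; ⌈_/2⌉; _/_; _+_; _*_; _∸_; _≤_; _<_; _≡ᵇ_; z≤n; s≤s; s≤s⁻¹)
open import Data.Nat.Properties
open import Data.Nat.DivMod using (m/n≡1+[m∸n]/n; m/n*n≤m; m*n/n≡m; /-monoˡ-≤)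
open import Data.Bool as Bool using (Bool; true; false; not)
open import Data.Bool.Properties using (T-≡; ¬-not)
open import Data.List using (List; []; _∷_; _++_; map; replicate; length; concatMap; upTo; cartesianProductWith; cartesianProduct)
open import Data.List.Properties using (++-identityʳ; length-map; length-++; ∷-injectiveʳ; map-cong-local)
open import Data.List.Relation.Unary.All as All using (All; []; _∷_)
open import Data.List.Relation.Unary.Any using (here; there)
open import Data.List.Membership.Propositional using (_∈_; find; lose)
open import Data.List.Membership.Propositional.Properties
  using (∈-map⁺; ∈-map⁻; ∈-++⁺ˡ; ∈-++⁺ʳ; ∈-++⁻; ∈-concatMap⁺; ∈-concatMap⁻; ∈-upTo⁺; ∈-upTo⁻; ∈-cartesianProductWith⁺; ∈-cartesianProductWith⁻; ∈-cartesianProduct⁺; ∈-cartesianProduct⁻)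
open import Data.List.Relation.Unary.Unique.Propositional using (Unique; []; _∷_)
import Data.List.Relation.Unary.Unique.Propositional.Properties as Unique
open import Data.Maybe using (Maybe; just; nothing)
open import Data.Nat.ListAction using (sum)
open import Data.Nat.Combinatorics using (_C_; nCk+nC[k+1]≡[n+1]C[k+1]; nCn≡1)
open import Data.Fin using (Fin; toℕ; fromℕ<)
open import Data.Fin.Properties using (toℕ-injective; toℕ<n; fromℕ<-toℕ; toℕ-fromℕ<)
open import Data.Vec using (lookup; tabulate)
open import Data.Vec.Properties using (lookup∘tabulate; tabulate∘lookup; tabulate-cong)
open import Data.Product as Product using (Σ; Σ-syntax; _×_; _,_; proj₁; proj₂; uncurry)
open import Data.Sum using (_⊎_; inj₁; inj₂; map₁)
open import Data.Empty using (⊥; ⊥-elim)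
open import Data.Unit using (⊤; tt)
open import Relation.Nullary using (¬_; Dec; yes; no)
open import Relation.Binary.PropositionalEquality
open import Data.Nat.Tactic.RingSolver using (solve-∀)
open import Function using (_∘_; _⇔_; mk⇔; Equivalence; case_of_)

⌈n/2⌉≤1+⌊n/2⌋ : ∀ n → ⌈ n /2⌉ ≤ suc ⌊ n /2⌋
⌈n/2⌉≤1+⌊n/2⌋ zero          = z≤n
⌈n/2⌉≤1+⌊n/2⌋ (suc zero)    = s≤s z≤n
⌈n/2⌉≤1+⌊n/2⌋ (suc (suc n)) = s≤s (⌈n/2⌉≤1+⌊n/2⌋ n)

⌊n/2⌋≡n/2 : ∀ n → ⌊ n /2⌋ ≡ n / 2
⌊n/2⌋≡n/2 zero          = refl
⌊n/2⌋≡n/2 (suc zero)    = refl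
⌊n/2⌋≡n/2 (suc (suc n)) = trans (cong suc (⌊n/2⌋≡n/2 n)) (sym (m/n≡1+[m∸n]/n {suc (suc n)} {2} (s≤s (s≤s z≤n))))

n≡1+[n∸1] : ∀ {n} → 1 ≤ n → n ≡ suc (n ∸ 1)
n≡1+[n∸1] {suc n} _ = refl

≤m∸1⇒< : ∀ {k m} → 1 ≤ k → k ≤ m ∸ 1 → k < m
≤m∸1⇒< {m = zero}  1≤k k≤0 = ⊥-elim (<⇒≱ 1≤k k≤0)
≤m∸1⇒< {m = suc m} _   k≤m = s≤s k≤m

<⇒≤m∸1 : ∀ {k m} → k < m → k ≤ m ∸ 1
<⇒≤m∸1 (s≤s k≤m) = k≤m

2m∸k∸t≡[k∸t]+2[m∸k] : ∀ {m k t} → t ≤ k → k ≤ m → 2 * m ∸ k ∸ t ≡ (k ∸ t) + 2 * (m ∸ k)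
2m∸k∸t≡[k∸t]+2[m∸k] {m} {k} {t} t≤k k≤m
  with a , refl ← m≤n⇒∃[o]m+o≡n t≤k | b , refl ← m≤n⇒∃[o]m+o≡n k≤m = begin
  2 * ((t + a) + b) ∸ (t + a) ∸ t         ≡⟨ cong (λ n → n ∸ (t + a) ∸ t) (regroup t a b) ⟩
  (t + a) + (t + (a + 2 * b)) ∸ (t + a) ∸ t ≡⟨ cong (_∸ t) (m+n∸m≡n (t + a) (t + (a + 2 * b))) ⟩
  t + (a + 2 * b) ∸ t                     ≡⟨ m+n∸m≡n t (a + 2 * b) ⟩
  a + 2 * b                               ≡⟨ cong₂ (λ x y → x + 2 * y) (sym (m+n∸m≡n t a)) (sym (m+n∸m≡n (t + a) b)) ⟩
  (t + a ∸ t) + 2 * ((t + a) + b ∸ (t + a)) ∎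
  where
  open ≡-Reasoning
  regroup : ∀ t a b → 2 * ((t + a) + b) ≡ (t + a) + (t + (a + 2 * b))
  regroup = solve-∀

2k+k≡k*3 : ∀ k → 2 * k + k ≡ k * 3
2k+k≡k*3 = solve-∀

≡ᵇ-true⇒≡ : ∀ {m n} → (m ≡ᵇ n) ≡ true → m ≡ n
≡ᵇ-true⇒≡ {m} {n} = ≡ᵇ⇒≡ m n ∘ Equivalence.from T-≡

≡ᵇ-refl : ∀ n → (n ≡ᵇ n) ≡ true
≡ᵇ-refl n = Equivalence.to T-≡ (≡⇒≡ᵇ n n refl)

≢⇒≡ᵇ-false : ∀ {m n} → m ≢ n → (m ≡ᵇ n) ≡ false
≢⇒≡ᵇ-false m≢n = ¬-not (m≢n ∘ ≡ᵇ-true⇒≡)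

replicate-suc-++ : ∀ {A : Set} n (d : A) w → replicate (suc n) d ++ w ≡ replicate n d ++ d ∷ w
replicate-suc-++ zero    d w = refl
replicate-suc-++ (suc n) d w = cong (d ∷_) (replicate-suc-++ n d w)

length-map-++-map : ∀ {A B C : Set} (f : A → C) (g : B → C) xs ys →
                    length (map f xs ++ map g ys) ≡ length xs + length ys
length-map-++-map f g xs ys = trans (length-++ (map f xs)) (cong₂ _+_ (length-map f xs) (length-map g ys))

map-unique : ∀ {A B : Set} (f : A → B) {xs} → (∀ {x y} → x ∈ xs → y ∈ xs → f x ≡ f y → x ≡ y) →
             Unique xs → Unique (map f xs)
map-unique f {[]}     _   []         = []
map-unique f {x ∷ xs} inj (x∉ ∷ u) =
  All.tabulate fx∉ ∷ map-unique f (λ x∈ y∈ → inj (there x∈) (there y∈)) u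
  where
  fx∉ : ∀ {z} → z ∈ map f xs → f x ≢ z
  fx∉ z∈ fx≡z with y , y∈ , refl ← ∈-map⁻ f z∈ = All.lookup x∉ y∈ (inj (here refl) (there y∈) fx≡z)

module _ {A B : Set} where

  ∈-concatMap-find : ∀ (f : A → List B) xs {y} → y ∈ concatMap f xs → Σ[ x ∈ A ] x ∈ xs × y ∈ f x
  ∈-concatMap-find f xs y∈ = find (∈-concatMap⁻ f {xs = xs} y∈)

  ∈-concatMap-lose : ∀ (f : A → List B) {xs x y} → x ∈ xs → y ∈ f x → y ∈ concatMap f xs
  ∈-concatMap-lose f x∈ y∈ = ∈-concatMap⁺ f (lose x∈ y∈)

  concatMap-unique : ∀ (f : A → List B) (label : B → A) {xs} → Unique xs → (∀ x → Unique (f x)) →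
                     (∀ x {y} → y ∈ f x → label y ≡ x) → Unique (concatMap f xs)
  concatMap-unique f label {[]}     _        _   _      = []
  concatMap-unique f label {x ∷ xs} (x∉ ∷ u) u-f labels =
    Unique.++⁺ (u-f x) (concatMap-unique f label u u-f labels) disjoint
    where
    disjoint : ∀ {y} → ¬ (y ∈ f x × y ∈ concatMap f xs)
    disjoint (y∈ , y∈′) with ∈-concatMap-find f xs y∈′
    ... | x′ , x′∈ , y∈f-x′ = All.lookup x∉ x′∈ (trans (sym (labels x y∈)) (labels x′ y∈f-x′))

  length-concatMap : ∀ (f : A → List B) xs → length (concatMap f xs) ≡ sum (map (length ∘ f) xs)
  length-concatMap f []       = refl
  length-concatMap f (x ∷ xs) = trans (length-++ (f x)) (cong (length (f x) +_) (length-concatMap f xs))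

  length-cartesianProductWith : ∀ {C : Set} (f : A → B → C) xs ys →
                                length (cartesianProductWith f xs ys) ≡ length xs * length ys
  length-cartesianProductWith f []       ys = refl
  length-cartesianProductWith f (x ∷ xs) ys =
    trans (length-++ (map (f x) ys)) (cong₂ _+_ (length-map (f x) ys) (length-cartesianProductWith f xs ys))

concatRange : ∀ {B : Set} → ℕ → ℕ → (ℕ → List B) → List B
concatRange a b g = concatMap (λ i → g (a + i)) (upTo (suc b ∸ a))

<1+b∸a⇒a+i≤b : ∀ a b i → i < suc b ∸ a → a + i ≤ b
<1+b∸a⇒a+i≤b zero    b       i (s≤s i≤b) = i≤b
<1+b∸a⇒a+i≤b (suc a) zero    i i<        = ⊥-elim (n≮0 (subst (i <_) (0∸n≡0 a) i<))
<1+b∸a⇒a+i≤b (suc a) (suc b) i i<        = s≤s (<1+b∸a⇒a+i≤b a b i i<)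

module _ {B : Set} where

  ∈-concatRange⁻ : ∀ a b (g : ℕ → List B) {y} → y ∈ concatRange a b g → Σ[ k ∈ ℕ ] a ≤ k × k ≤ b × y ∈ g k
  ∈-concatRange⁻ a b g y∈ with ∈-concatMap-find (λ i → g (a + i)) (upTo (suc b ∸ a)) y∈
  ... | i , i∈ , y∈g = a + i , m≤m+n a i , <1+b∸a⇒a+i≤b a b i (∈-upTo⁻ i∈) , y∈g

  ∈-concatRange⁺ : ∀ a b (g : ℕ → List B) {k y} → a ≤ k → k ≤ b → y ∈ g k → y ∈ concatRange a b g
  ∈-concatRange⁺ a b g {k} a≤k k≤b y∈ =
    ∈-concatMap-lose (λ i → g (a + i)) (∈-upTo⁺ k∸a<) (subst (λ k → _ ∈ g k) (sym (m+[n∸m]≡n a≤k)) y∈)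
    where
    k∸a< : k ∸ a < suc b ∸ a
    k∸a< = subst (k ∸ a <_) (sym (+-∸-assoc 1 (≤-trans a≤k k≤b))) (s≤s (∸-monoˡ-≤ a k≤b))

  concatRange-unique : ∀ a b (g : ℕ → List B) (label : B → ℕ) → (∀ k → Unique (g k)) →
                       (∀ k {y} → y ∈ g k → label y ≡ k) → Unique (concatRange a b g)
  concatRange-unique a b g label u-g labels =
    concatMap-unique (λ i → g (a + i)) (λ y → label y ∸ a) (Unique.upTo⁺ (suc b ∸ a)) (λ i → u-g (a + i))
      (λ i y∈ → trans (cong (_∸ a) (labels (a + i) y∈)) (m+n∸m≡n a i))

  length-concatRange : ∀ a b (g : ℕ → List B) (f : ℕ → ℕ) → (∀ k → a ≤ k → k ≤ b → length (g k) ≡ f k) →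
                       length (concatRange a b g) ≡ sumRange a b f
  length-concatRange a b g f length-g =
    trans (length-concatMap (λ i → g (a + i)) (upTo (suc b ∸ a)))
          (cong sum (map-cong-local (All.tabulate λ {i} i∈ →
            length-g (a + i) (m≤m+n a i) (<1+b∸a⇒a+i≤b a b i (∈-upTo⁻ i∈)))))

Positive : List ℕ → Set
Positive = All (1 ≤_)

positive-length≤sum : ∀ xs → Positive xs → length xs ≤ sum xs
positive-length≤sum []       []         = z≤n
positive-length≤sum (x ∷ xs) (px ∷ pxs) = +-mono-≤ px (positive-length≤sum xs pxs)

odds evens : List ℕ → List ℕ
odds  []       = []
odds  (x ∷ xs) = x ∷ evens xs
evens []       = []
evens (x ∷ xs) = odds xs

interleave : List ℕ → List ℕ → List ℕ
interleave []       ys = ys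
interleave (x ∷ xs) ys = x ∷ interleave ys xs

interleave-odds-evens : ∀ xs → interleave (odds xs) (evens xs) ≡ xs
interleave-odds-evens []       = refl
interleave-odds-evens (x ∷ xs) = cong (x ∷_) (interleave-odds-evens xs)

odds-evens-interleave : ∀ xs ys → length ys ≤ length xs → length xs ≤ suc (length ys) →
                        odds (interleave xs ys) ≡ xs × evens (interleave xs ys) ≡ ys
odds-evens-interleave []       []       _  _  = refl , refl
odds-evens-interleave (x ∷ xs) ys       ys≤ xs≤ =
  let (o , e) = odds-evens-interleave ys xs (s≤s⁻¹ xs≤) ys≤ in cong (x ∷_) e , o

length-interleave : ∀ xs ys → length (interleave xs ys) ≡ length xs + length ys
length-interleave []       ys = refl
length-interleave (x ∷ xs) ys = cong suc (trans (length-interleave ys xs) (+-comm (length ys) (length xs)))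

length-odds-evens : ∀ xs → length (odds xs) ≡ ⌈ length xs /2⌉ × length (evens xs) ≡ ⌊ length xs /2⌋
length-odds-evens []       = refl , refl
length-odds-evens (x ∷ xs) = let (o , e) = length-odds-evens xs in cong suc e , o

odds-evens-positive : ∀ xs → Positive xs → Positive (odds xs) × Positive (evens xs)
odds-evens-positive []       []         = [] , []
odds-evens-positive (x ∷ xs) (px ∷ pxs) = let (o , e) = odds-evens-positive xs pxs in px ∷ e , o

interleave-positive : ∀ xs ys → Positive xs → Positive ys → Positive (interleave xs ys)
interleave-positive []       ys []         pys = pys
interleave-positive (x ∷ xs) ys (px ∷ pxs) pys = px ∷ interleave-positive ys xs pys pxs

-- Antichains of points in ℕ²

_≻_ : ℕ × ℕ → ℕ × ℕ → Set
(x , y) ≻ (z , w) = (z ≤ x × w ≤ y) × (z < x ⊎ w < y)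

Incomparable : ℕ × ℕ → ℕ × ℕ → Set
Incomparable a b = ¬ (a ≻ b) × ¬ (b ≻ a)

<×>⇒incomparable : ∀ {x y x′ y′} → x < x′ → y′ < y → Incomparable (x , y) (x′ , y′)
<×>⇒incomparable x<x′ y′<y =
  (λ ((x′≤x , _) , _) → <⇒≱ x<x′ x′≤x) , (λ ((_ , y≤y′) , _) → <⇒≱ y′<y y≤y′)

incomparable-sym : ∀ {a b} → Incomparable a b → Incomparable b a
incomparable-sym (p , q) = q , p

≤×≤⇒≻ : ∀ {x y x′ y′} → x ≤ x′ → y ≤ y′ → (x , y) ≢ (x′ , y′) → (x′ , y′) ≻ (x , y)
≤×≤⇒≻ x≤x′ y≤y′ ne with m≤n⇒m<n∨m≡n x≤x′ | m≤n⇒m<n∨m≡n y≤y′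
... | inj₁ x<x′ | _         = (x≤x′ , y≤y′) , inj₁ x<x′
... | inj₂ _    | inj₁ y<y′ = (x≤x′ , y≤y′) , inj₂ y<y′
... | inj₂ refl | inj₂ refl = ⊥-elim (ne refl)

≻-shift : ∀ {x y x′ y′} → (x , y) ≻ (x′ , y′) → (suc x , y) ≻ (suc x′ , y′)
≻-shift ((x′≤x , y′≤y) , lt) = (s≤s x′≤x , y′≤y) , map₁ s≤s lt

≻-unshift : ∀ {x y x′ y′} → (suc x , y) ≻ (suc x′ , y′) → (x , y) ≻ (x′ , y′)
≻-unshift ((x′≤x , y′≤y) , lt) = (s≤s⁻¹ x′≤x , y′≤y) , map₁ s≤s⁻¹ lt

incomparable-shift : ∀ {x y x′ y′} → Incomparable (x , y) (x′ , y′) → Incomparable (suc x , y) (suc x′ , y′)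
incomparable-shift (p , q) = p ∘ ≻-unshift , q ∘ ≻-unshift

incomparable-unshift : ∀ {x y x′ y′} → Incomparable (suc x , y) (suc x′ , y′) → Incomparable (x , y) (x′ , y′)
incomparable-unshift (p , q) = p ∘ ≻-shift , q ∘ ≻-shift

PointSet : Set
PointSet = ℕ → ℕ → Bool

_∈ₚ_ : ℕ × ℕ → PointSet → Set
(x , y) ∈ₚ f = f x y ≡ true

_⊆ₚ_ : PointSet → PointSet → Set
f ⊆ₚ g = ∀ a → a ∈ₚ f → a ∈ₚ g

IsAntichainₚ : PointSet → Set
IsAntichainₚ f = ∀ a b → a ∈ₚ f → b ∈ₚ f → a ≢ b → Incomparable a b

InBox : ℕ → ℕ → PointSet → Set
InBox w h f = ∀ x y → (x , y) ∈ₚ f → x < w × y < h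

record IsMaximalIn (w h : ℕ) (f : PointSet) : Set where
  constructor isMaximalIn
  field
    inBox     : InBox w h f
    antichain : IsAntichainₚ f
    maximal   : ∀ g → InBox w h g → IsAntichainₚ g → f ⊆ₚ g → g ⊆ₚ f

antichain-no-≤×≤ : ∀ {f x y x′ y′} → IsAntichainₚ f → (x , y) ∈ₚ f → (x′ , y′) ∈ₚ f →
                   x ≤ x′ → y ≤ y′ → (x , y) ≢ (x′ , y′) → ⊥
antichain-no-≤×≤ ac a∈ b∈ x≤x′ y≤y′ ne = proj₂ (ac _ _ a∈ b∈ ne) (≤×≤⇒≻ x≤x′ y≤y′ ne)

antichain-column-unique : ∀ {f x y y′} → IsAntichainₚ f → (x , y) ∈ₚ f → (x , y′) ∈ₚ f → y ≡ y′
antichain-column-unique {y = y} {y′} ac a∈ b∈ with y ≟ y′ | ≤-total y y′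
... | yes y≡y′ | _         = y≡y′
... | no y≢y′  | inj₁ y≤y′ = ⊥-elim (antichain-no-≤×≤ ac a∈ b∈ ≤-refl y≤y′ (y≢y′ ∘ cong proj₂))
... | no y≢y′  | inj₂ y′≤y = ⊥-elim (antichain-no-≤×≤ ac b∈ a∈ ≤-refl y′≤y (y≢y′ ∘ sym ∘ cong proj₂))

_≐_ : PointSet → PointSet → Set
f ≐ g = ∀ x y → f x y ≡ g x y

≐-sym : ∀ {f g} → f ≐ g → g ≐ f
≐-sym f≐g x y = sym (f≐g x y)

_∈ₚ?_ : ∀ a f → Dec (a ∈ₚ f)
(x , y) ∈ₚ? f = f x y Bool.≟ true

shiftˣ : PointSet → PointSet
shiftˣ f zero    y = false
shiftˣ f (suc x) y = f x y

consˣ : ℕ → PointSet → PointSet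
consˣ c f zero    y = y ≡ᵇ c
consˣ c f (suc x) y = f x y

tailˣ : PointSet → PointSet
tailˣ f x y = f (suc x) y

tailˣ-antichain : ∀ {f} → IsAntichainₚ f → IsAntichainₚ (tailˣ f)
tailˣ-antichain ac (x , y) (x′ , y′) a∈ b∈ ne =
  incomparable-unshift (ac (suc x , y) (suc x′ , y′) a∈ b∈ (ne ∘ cong (λ (u , v) → (pred u , v))))

shiftˣ-antichain : ∀ {f} → IsAntichainₚ f → IsAntichainₚ (shiftˣ f)
shiftˣ-antichain ac (suc x , y) (suc x′ , y′) a∈ b∈ ne =
  incomparable-shift (ac (x , y) (x′ , y′) a∈ b∈ (ne ∘ cong (λ (u , v) → (suc u , v))))

shiftˣ-inBox : ∀ {w h f} → InBox w h f → InBox (suc w) h (shiftˣ f)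
shiftˣ-inBox bx (suc x) y a∈ = let (x<w , y<h) = bx x y a∈ in s≤s x<w , y<h

consˣ-inBox : ∀ {w c f} → InBox w c f → InBox (suc w) (suc c) (consˣ c f)
consˣ-inBox bx zero    y a∈ rewrite ≡ᵇ-true⇒≡ {y} a∈ = s≤s z≤n , ≤-refl
consˣ-inBox bx (suc x) y a∈ = let (x<w , y<c) = bx x y a∈ in s≤s x<w , m≤n⇒m≤1+n y<c

consˣ-antichain : ∀ {w c f} → InBox w c f → IsAntichainₚ f → IsAntichainₚ (consˣ c f)
consˣ-antichain bx ac (zero , y) (zero , y′) a∈ b∈ ne
  rewrite ≡ᵇ-true⇒≡ {y} a∈ | ≡ᵇ-true⇒≡ {y′} b∈ = ⊥-elim (ne refl)
consˣ-antichain bx ac (zero , y) (suc x′ , y′) a∈ b∈ ne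
  rewrite ≡ᵇ-true⇒≡ {y} a∈ = <×>⇒incomparable z<s (proj₂ (bx x′ y′ b∈))
consˣ-antichain bx ac (suc x , y) (zero , y′) a∈ b∈ ne
  rewrite ≡ᵇ-true⇒≡ {y′} b∈ = incomparable-sym (<×>⇒incomparable z<s (proj₂ (bx x y a∈)))
consˣ-antichain {f = f} bx ac (suc x , y) (suc x′ , y′) =
  shiftˣ-antichain {f} ac (suc x , y) (suc x′ , y′)

tailˣ-inBox : ∀ {w h g} → InBox (suc w) h g → InBox w h (tailˣ g)
tailˣ-inBox bx x y a∈ = let (x<w , y<h) = bx (suc x) y a∈ in s≤s⁻¹ x<w , y<h

inBox-mono : ∀ {w h w′ h′ f} → w ≤ w′ → h ≤ h′ → InBox w h f → InBox w′ h′ f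
inBox-mono w≤w′ h≤h′ bx x y a∈ = let (x<w , y<h) = bx x y a∈ in <-≤-trans x<w w≤w′ , <-≤-trans y<h h≤h′

maximal-inBox-mono : ∀ {w h w′ h′ f} → w ≤ w′ → h ≤ h′ → IsMaximalIn w′ h′ f → InBox w h f → IsMaximalIn w h f
maximal-inBox-mono w≤w′ h≤h′ M bx =
  isMaximalIn bx antichain (λ g bg → maximal g (inBox-mono w≤w′ h≤h′ bg))
  where open IsMaximalIn M

maximal-≐ : ∀ {w h f g} → f ≐ g → IsMaximalIn w h f → IsMaximalIn w h g
maximal-≐ f≐g M =
  isMaximalIn (λ x y a∈ → inBox x y (trans (f≐g x y) a∈))
              (λ a b a∈ b∈ → antichain a b (trans (f≐g _ _) a∈) (trans (f≐g _ _) b∈))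
              (λ h bh ah g⊆h (x , y) a∈ →
                 trans (sym (f≐g x y)) (maximal h bh ah (λ (x , y) b∈ → g⊆h (x , y) (trans (sym (f≐g x y)) b∈)) (x , y) a∈))
  where open IsMaximalIn M

inBox-below-first-column : ∀ {w h y₀ g} → InBox w (suc h) g → IsAntichainₚ g →
                           (0 , y₀) ∈ₚ g → y₀ < h → InBox w h g
inBox-below-first-column bx ac y₀∈ y₀<h x y a∈ with bx x y a∈
... | x<w , y<1+h with m<1+n⇒m<n∨m≡n y<1+h
...   | inj₁ y<h  = x<w , y<h
...   | inj₂ refl = ⊥-elim (antichain-no-≤×≤ ac y₀∈ a∈ z≤n (<⇒≤ y₀<h) (<⇒≢ y₀<h ∘ cong proj₂))

tailˣ-inBox-below-corner : ∀ {w h g} → InBox (suc w) (suc h) g → IsAntichainₚ g →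
                           (0 , h) ∈ₚ g → InBox w h (tailˣ g)
tailˣ-inBox-below-corner bx ac corner x y a∈ with bx (suc x) y a∈
... | s≤s x<w , y<1+h with m<1+n⇒m<n∨m≡n y<1+h
...   | inj₁ y<h  = x<w , y<h
...   | inj₂ refl = ⊥-elim (antichain-no-≤×≤ ac corner a∈ z≤n ≤-refl (λ ()))

first-column-empty : ∀ {w c x₀ g} → InBox w (suc c) g → IsAntichainₚ g →
                     (suc x₀ , c) ∈ₚ g → ∀ y → ¬ (0 , y) ∈ₚ g
first-column-empty bx ac x₀∈ y a∈ =
  antichain-no-≤×≤ ac a∈ x₀∈ z≤n (s≤s⁻¹ (proj₂ (bx 0 y a∈))) (λ ())

TopRowOccupied : ℕ → PointSet → Set
TopRowOccupied zero    f = ⊤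
TopRowOccupied (suc c) f = Σ[ x ∈ ℕ ] (x , c) ∈ₚ f

FirstColumnOccupied : ℕ → PointSet → Set
FirstColumnOccupied zero    f = ⊤
FirstColumnOccupied (suc _) f = Σ[ y ∈ ℕ ] (0 , y) ∈ₚ f

first-column-blocked : ∀ {w h f g} → TopRowOccupied h f → InBox (suc w) h g → IsAntichainₚ g →
                       shiftˣ f ⊆ₚ g → ∀ y → ¬ (0 , y) ∈ₚ g
first-column-blocked {h = zero}  _        bx _  _   y a∈ = n≮0 (proj₂ (bx 0 y a∈))
first-column-blocked {h = suc c} (x , x∈) bx ac sub y    = first-column-empty bx ac (sub (suc x , c) x∈) y

consˣ-maximal : ∀ {w h f} → IsMaximalIn w h f → IsMaximalIn (suc w) (suc h) (consˣ h f)
consˣ-maximal {w} {h} {f} M = isMaximalIn (consˣ-inBox inBox) (consˣ-antichain inBox antichain) max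
  where
  open IsMaximalIn M
  max : ∀ g → InBox (suc w) (suc h) g → IsAntichainₚ g → consˣ h f ⊆ₚ g → g ⊆ₚ consˣ h f
  max g bx ac sub (zero , y) a∈
    rewrite antichain-column-unique ac a∈ (sub (0 , h) (≡ᵇ-refl h)) = ≡ᵇ-refl h
  max g bx ac sub (suc x , y) a∈ =
    maximal (tailˣ g) (tailˣ-inBox-below-corner bx ac (sub (0 , h) (≡ᵇ-refl h))) (tailˣ-antichain ac)
            (λ (x , y) → sub (suc x , y)) (x , y) a∈

shiftˣ-maximal : ∀ {w h f} → IsMaximalIn w h f → TopRowOccupied h f → IsMaximalIn (suc w) h (shiftˣ f)
shiftˣ-maximal {w} {h} {f} M top = isMaximalIn (shiftˣ-inBox inBox) (shiftˣ-antichain antichain) max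
  where
  open IsMaximalIn M
  max : ∀ g → InBox (suc w) h g → IsAntichainₚ g → shiftˣ f ⊆ₚ g → g ⊆ₚ shiftˣ f
  max g bx ac sub (zero , y) a∈ = ⊥-elim (first-column-blocked top bx ac sub y a∈)
  max g bx ac sub (suc x , y) a∈ =
    maximal (tailˣ g) (tailˣ-inBox bx) (tailˣ-antichain ac)
            (λ (x , y) → sub (suc x , y)) (x , y) a∈

top-row-blocked : ∀ {w h f g} → InBox w h f → FirstColumnOccupied w f →
                  InBox w (suc h) g → IsAntichainₚ g → f ⊆ₚ g → InBox w h g
top-row-blocked {w = zero}  _  _          bx _  _   x y a∈ = ⊥-elim (n≮0 (proj₁ (bx x y a∈)))
top-row-blocked {w = suc _} bf (y₀ , y₀∈) bx ac sub =
  inBox-below-first-column bx ac (sub (0 , y₀) y₀∈) (proj₂ (bf 0 y₀ y₀∈))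

taller-maximal : ∀ {w h f} → IsMaximalIn w h f → FirstColumnOccupied w f → IsMaximalIn w (suc h) f
taller-maximal {h = h} M first =
  isMaximalIn (inBox-mono ≤-refl (n≤1+n h) inBox) antichain
              (λ g bx ac sub → maximal g (top-row-blocked inBox first bx ac sub) ac sub)
  where open IsMaximalIn M

tailˣ-maximal-of-corner : ∀ {w h F} → IsMaximalIn (suc w) (suc h) F → (0 , h) ∈ₚ F →
                          IsMaximalIn w h (tailˣ F)
tailˣ-maximal-of-corner {w} {h} {F} M corner =
  isMaximalIn (tailˣ-inBox-below-corner inBox antichain corner) (tailˣ-antichain antichain) max
  where
  open IsMaximalIn M
  max : ∀ g → InBox w h g → IsAntichainₚ g → tailˣ F ⊆ₚ g → g ⊆ₚ tailˣ F
  max g bg ag sub (x , y) =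
    maximal (consˣ h g) (consˣ-inBox bg) (consˣ-antichain bg ag) F⊆ (suc x , y)
    where
    F⊆ : F ⊆ₚ consˣ h g
    F⊆ (zero  , y) a∈ rewrite antichain-column-unique antichain a∈ corner = ≡ᵇ-refl h
    F⊆ (suc x , y) a∈ = sub (x , y) a∈

consˣ-tailˣ : ∀ {F h} → IsAntichainₚ F → (0 , h) ∈ₚ F → consˣ h (tailˣ F) ≐ F
consˣ-tailˣ {F} {h} ac corner zero y with y ≟ h
... | yes refl = trans (≡ᵇ-refl y) (sym corner)
... | no y≢h   = trans (≢⇒≡ᵇ-false y≢h) (sym (¬-not (y≢h ∘ λ a∈ → antichain-column-unique ac a∈ corner)))
consˣ-tailˣ ac corner (suc x) y = refl

tailˣ-maximal-of-empty-column : ∀ {w h F} → IsMaximalIn (suc w) h F → (∀ y → ¬ (0 , y) ∈ₚ F) →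
                                IsMaximalIn w h (tailˣ F)
tailˣ-maximal-of-empty-column {w} {h} {F} M empty =
  isMaximalIn (tailˣ-inBox inBox) (tailˣ-antichain antichain) max
  where
  open IsMaximalIn M
  max : ∀ g → InBox w h g → IsAntichainₚ g → tailˣ F ⊆ₚ g → g ⊆ₚ tailˣ F
  max g bg ag sub (x , y) =
    maximal (shiftˣ g) (shiftˣ-inBox bg) (shiftˣ-antichain ag) F⊆ (suc x , y)
    where
    F⊆ : F ⊆ₚ shiftˣ g
    F⊆ (zero  , y) a∈ = ⊥-elim (empty y a∈)
    F⊆ (suc x , y) a∈ = sub (x , y) a∈

shiftˣ-tailˣ : ∀ {F} → (∀ y → ¬ (0 , y) ∈ₚ F) → shiftˣ (tailˣ F) ≐ F
shiftˣ-tailˣ empty zero    y = sym (¬-not (empty y))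
shiftˣ-tailˣ empty (suc x) y = refl

-- Otherwise (0, h) could be added: consˣ h (tailˣ F) would be a larger antichain.
corner-occupied : ∀ {w h F} → IsMaximalIn (suc w) (suc h) F →
                  (∀ y → y < h → ¬ (0 , y) ∈ₚ F) → (∀ x → x < w → ¬ (suc x , h) ∈ₚ F) → (0 , h) ∈ₚ F
corner-occupied {w} {h} {F} M column-empty row-empty =
  maximal (consˣ h (tailˣ F)) (consˣ-inBox tail-inBox) (consˣ-antichain tail-inBox (tailˣ-antichain antichain))
          F⊆ (0 , h) (≡ᵇ-refl h)
  where
  open IsMaximalIn M
  tail-inBox : InBox w h (tailˣ F)
  tail-inBox x y a∈ with inBox (suc x) y a∈
  ... | s≤s x<w , y<1+h with m<1+n⇒m<n∨m≡n y<1+h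
  ...   | inj₁ y<h  = x<w , y<h
  ...   | inj₂ refl = ⊥-elim (row-empty x x<w a∈)
  F⊆ : F ⊆ₚ consˣ h (tailˣ F)
  F⊆ (zero , y) a∈ with m<1+n⇒m<n∨m≡n (proj₂ (inBox 0 y a∈))
  ... | inj₁ y<h  = ⊥-elim (column-empty y y<h a∈)
  ... | inj₂ refl = ≡ᵇ-refl y
  F⊆ (suc x , y) a∈ = a∈

-- Staircase paths

data Step : Set where
  D E N : Step

Path : Set
Path = List Step

-- Directions are Booleans: true is horizontal (the E step), false vertical (the N step).
moves : Bool → Step → ℕ
moves _     D = 1
moves true  E = 1
moves true  N = 0
moves false E = 0
moves false N = 1

extent : Bool → Path → ℕ
extent b []      = 0
extent b (s ∷ p) = moves b s + extent b p

width height : Path → ℕ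
width  = extent true
height = extent false

-- A path is read from the top-left corner of its box: D puts a point in the current column at the
-- top of the remaining box and moves one column right and one row down, E moves right, N moves down.
points : Path → PointSet
points []      x y = false
points (D ∷ p) = consˣ (height p) (points p)
points (E ∷ p) = shiftˣ (points p)
points (N ∷ p) = points p

NoLeadingN NoLeadingE : Path → Set
NoLeadingN (N ∷ _) = ⊥
NoLeadingN _       = ⊤
NoLeadingE (E ∷ _) = ⊥
NoLeadingE _       = ⊤

data Valid : Path → Set where
  []  : Valid []
  D∷_ : ∀ {p} → Valid p → Valid (D ∷ p)
  E∷  : ∀ {p} → Valid p → NoLeadingN p → Valid (E ∷ p)
  N∷  : ∀ {p} → Valid p → NoLeadingE p → Valid (N ∷ p)

points-inBox : ∀ p → InBox (width p) (height p) (points p)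
points-inBox (D ∷ p) = consˣ-inBox (points-inBox p)
points-inBox (E ∷ p) = shiftˣ-inBox (points-inBox p)
points-inBox (N ∷ p) x y a∈ = let (x<w , y<h) = points-inBox p x y a∈ in x<w , m≤n⇒m≤1+n y<h

points-antichain : ∀ p → IsAntichainₚ (points p)
points-antichain (D ∷ p) = consˣ-antichain (points-inBox p) (points-antichain p)
points-antichain (E ∷ p) = shiftˣ-antichain (points-antichain p)
points-antichain (N ∷ p) = points-antichain p

top-row-occupied : ∀ p → Valid p → NoLeadingN p → TopRowOccupied (height p) (points p)
top-row-occupied []      _        _ = tt
top-row-occupied (D ∷ p) _        _ = 0 , ≡ᵇ-refl (height p)
top-row-occupied (E ∷ p) (E∷ v n) _ = shift-occupied (height p) (top-row-occupied p v n)
  where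
  shift-occupied : ∀ h {f} → TopRowOccupied h f → TopRowOccupied h (shiftˣ f)
  shift-occupied zero    _        = tt
  shift-occupied (suc _) (x , x∈) = suc x , x∈

first-column-occupied : ∀ p → Valid p → NoLeadingE p → FirstColumnOccupied (width p) (points p)
first-column-occupied []      _        _ = tt
first-column-occupied (D ∷ p) _        _ = height p , ≡ᵇ-refl (height p)
first-column-occupied (N ∷ p) (N∷ v n) _ = first-column-occupied p v n

points-maximal : ∀ p → Valid p → IsMaximalIn (width p) (height p) (points p)
points-maximal []      []       =
  isMaximalIn (λ _ _ ()) (λ _ _ ()) (λ g bx _ _ (x , y) a∈ → ⊥-elim (n≮0 (proj₁ (bx x y a∈))))
points-maximal (D ∷ p) (D∷ v)   = consˣ-maximal (points-maximal p v)
points-maximal (E ∷ p) (E∷ v n) = shiftˣ-maximal (points-maximal p v) (top-row-occupied p v n)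
points-maximal (N ∷ p) (N∷ v n) = taller-maximal (points-maximal p v) (first-column-occupied p v n)

D≢E : ∀ p q → ¬ points (D ∷ p) ≐ points (E ∷ q)
D≢E p q eq with trans (sym (eq 0 (height p))) (≡ᵇ-refl (height p))
... | ()

D≢N : ∀ p q → height p ≡ height q → ¬ points (D ∷ p) ≐ points (N ∷ q)
D≢N p q h≡ eq = <-irrefl h≡ (proj₂ (points-inBox q 0 (height p) (trans (sym (eq 0 (height p))) (≡ᵇ-refl (height p)))))

E≢N : ∀ p q → Valid q → NoLeadingE q → suc (width p) ≡ width q → ¬ points (E ∷ p) ≐ points (N ∷ q)
E≢N p q v n w≡ eq with width q | first-column-occupied q v n
E≢N p q v n refl eq | suc _ | y₀ , y₀∈ with trans (eq 0 y₀) y₀∈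
... | ()

points-injective : ∀ p q → Valid p → Valid q → width p ≡ width q → height p ≡ height q →
                   points p ≐ points q → p ≡ q
points-injective []      []      _        _        _  _  _  = refl
points-injective []      (D ∷ q) _        _        ()
points-injective []      (E ∷ q) _        _        ()
points-injective []      (N ∷ q) _        _        _  ()
points-injective (D ∷ p) []      _        _        ()
points-injective (E ∷ p) []      _        _        ()
points-injective (N ∷ p) []      _        _        _  ()
points-injective (D ∷ p) (D ∷ q) (D∷ v)   (D∷ v′)   w≡ h≡ eq =
  cong (D ∷_) (points-injective p q v v′ (suc-injective w≡) (suc-injective h≡) (eq ∘ suc))
points-injective (E ∷ p) (E ∷ q) (E∷ v _) (E∷ v′ _) w≡ h≡ eq =
  cong (E ∷_) (points-injective p q v v′ (suc-injective w≡) h≡ (eq ∘ suc))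
points-injective (N ∷ p) (N ∷ q) (N∷ v _) (N∷ v′ _) w≡ h≡ eq =
  cong (N ∷_) (points-injective p q v v′ w≡ (suc-injective h≡) eq)
points-injective (D ∷ p) (E ∷ q) _        _         _  _  eq = ⊥-elim (D≢E p q eq)
points-injective (E ∷ p) (D ∷ q) _        _         _  _  eq = ⊥-elim (D≢E q p (≐-sym eq))
points-injective (D ∷ p) (N ∷ q) _        _         _  h≡ eq = ⊥-elim (D≢N p q (suc-injective h≡) eq)
points-injective (N ∷ p) (D ∷ q) _        _         _  h≡ eq = ⊥-elim (D≢N q p (suc-injective (sym h≡)) (≐-sym eq))
points-injective (E ∷ p) (N ∷ q) _        (N∷ v′ n) w≡ _  eq = ⊥-elim (E≢N p q v′ n w≡ eq)
points-injective (N ∷ p) (E ∷ q) (N∷ v n) _         w≡ _  eq = ⊥-elim (E≢N q p v n (sym w≡) (≐-sym eq))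

record IsSquarePath (m : ℕ) (p : Path) : Set where
  constructor isSquarePath
  field
    valid   : Valid p
    width≡  : width p ≡ m
    height≡ : height p ≡ m

square-maximal : ∀ {m p} → IsSquarePath m p → IsMaximalIn m m (points p)
square-maximal {m} {p} (isSquarePath v w≡ h≡) =
  subst₂ (λ w h → IsMaximalIn w h (points p)) w≡ h≡ (points-maximal p v)

noLeadingE-of-occupied : ∀ p → FirstColumnOccupied (width p) (points p) → NoLeadingE p
noLeadingE-of-occupied []      _ = tt
noLeadingE-of-occupied (D ∷ p) _ = tt
noLeadingE-of-occupied (N ∷ p) _ = tt
noLeadingE-of-occupied (E ∷ p) (_ , ())

noLeadingN-of-occupied : ∀ p → TopRowOccupied (height p) (points p) → NoLeadingN p
noLeadingN-of-occupied []      _ = tt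
noLeadingN-of-occupied (D ∷ p) _ = tt
noLeadingN-of-occupied (E ∷ p) _ = tt
noLeadingN-of-occupied (N ∷ p) (x , x∈) = <-irrefl refl (proj₂ (points-inBox p x (height p) x∈))

record Realisation (w h : ℕ) (F : PointSet) : Set where
  constructor realisation
  field
    path    : Path
    valid   : Valid path
    width≡  : width path ≡ w
    height≡ : height path ≡ h
    points≐ : points path ≐ F

realise-D : ∀ {w h F} → IsAntichainₚ F → (0 , h) ∈ₚ F → Realisation w h (tailˣ F) → Realisation (suc w) (suc h) F
realise-D {F = F} ac corner (realisation p v refl refl p≐) =
  realisation (D ∷ p) (D∷ v) refl refl points≐
  where
  points≐ : points (D ∷ p) ≐ F
  points≐ zero    y = consˣ-tailˣ ac corner zero y
  points≐ (suc x) y = p≐ x y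

realise-E : ∀ {w h F} → (∀ y → ¬ (0 , y) ∈ₚ F) → TopRowOccupied h (tailˣ F) →
            Realisation w h (tailˣ F) → Realisation (suc w) h F
realise-E {F = F} empty top (realisation p v refl refl p≐) =
  realisation (E ∷ p) (E∷ v (noLeadingN-of-occupied p (occupied-transport (height p) top))) refl refl points≐
  where
  occupied-transport : ∀ h → TopRowOccupied h (tailˣ F) → TopRowOccupied h (points p)
  occupied-transport zero    _        = tt
  occupied-transport (suc _) (x , x∈) = x , trans (p≐ x _) x∈
  points≐ : points (E ∷ p) ≐ F
  points≐ zero    y = shiftˣ-tailˣ {F} empty zero y
  points≐ (suc x) y = p≐ x y

realise-N : ∀ {w h F} → FirstColumnOccupied w F → Realisation w h F → Realisation w (suc h) F
realise-N {F = F} first (realisation p v refl refl p≐) =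
  realisation (N ∷ p) (N∷ v (noLeadingE-of-occupied p (occupied-transport (width p) first))) refl refl p≐
  where
  occupied-transport : ∀ w → FirstColumnOccupied w F → FirstColumnOccupied w (points p)
  occupied-transport zero    _        = tt
  occupied-transport (suc _) (y , y∈) = y , trans (p≐ 0 y) y∈

realise : ∀ w h F → IsMaximalIn w h F → Realisation w h F
realise zero zero F M =
  realisation [] [] refl refl (λ x y → sym (¬-not (λ a∈ → n≮0 (proj₁ (IsMaximalIn.inBox M x y a∈)))))
realise zero (suc h) F M =
  realise-N tt (realise 0 h F (maximal-inBox-mono ≤-refl (n≤1+n h) M
                                 (λ x y a∈ → ⊥-elim (n≮0 (proj₁ (IsMaximalIn.inBox M x y a∈))))))
realise (suc w) zero F M =
  realise-E empty tt (realise w 0 (tailˣ F) (tailˣ-maximal-of-empty-column M empty))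
  where
  empty : ∀ y → ¬ (0 , y) ∈ₚ F
  empty y a∈ = n≮0 (proj₂ (IsMaximalIn.inBox M 0 y a∈))
realise (suc w) (suc h) F M with (0 , h) ∈ₚ? F
... | yes corner = realise-D antichain corner (realise w h (tailˣ F) (tailˣ-maximal-of-corner M corner))
  where open IsMaximalIn M
... | no ¬corner with anyUpTo? (λ y → (0 , y) ∈ₚ? F) h | anyUpTo? (λ x → (suc x , h) ∈ₚ? F) w
...   | yes (y₀ , y₀<h , y₀∈) | _ =
  realise-N (y₀ , y₀∈) (realise (suc w) h F (maximal-inBox-mono ≤-refl (n≤1+n h) M
                                               (inBox-below-first-column inBox antichain y₀∈ y₀<h)))
  where open IsMaximalIn M
...   | no _ | yes (x₀ , _ , x₀∈) =
  realise-E empty (x₀ , x₀∈) (realise w (suc h) (tailˣ F) (tailˣ-maximal-of-empty-column M empty))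
  where
  open IsMaximalIn M
  empty = first-column-empty inBox antichain x₀∈
...   | no column-empty | no row-empty =
  ⊥-elim (¬corner (corner-occupied M (λ y y<h y∈ → column-empty (y , y<h , y∈))
                                     (λ x x<w x∈ → row-empty (x , x<w , x∈))))

pointSet : ∀ {m} → Grid m → PointSet
pointSet {m} S x y with x <? m | y <? m
... | yes x<m | yes y<m = lookup (lookup S (fromℕ< x<m)) (fromℕ< y<m)
... | _       | _       = false

grid : ∀ {m} → PointSet → Grid m
grid f = tabulate λ i → tabulate λ j → f (toℕ i) (toℕ j)

pointSet-toℕ : ∀ {m} (S : Grid m) i j → pointSet S (toℕ i) (toℕ j) ≡ lookup (lookup S i) j
pointSet-toℕ {m} S i j with toℕ i <? m | toℕ j <? m
... | yes i<m | yes j<m rewrite fromℕ<-toℕ i i<m | fromℕ<-toℕ j j<m = refl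
... | yes _   | no j≮m  = ⊥-elim (j≮m (toℕ<n j))
... | no i≮m  | _       = ⊥-elim (i≮m (toℕ<n i))

pointSet-elim : ∀ {m} (S : Grid m) {P : ℕ → ℕ → Set} → (∀ i j → (i , j) ∈G S → P (toℕ i) (toℕ j)) →
                ∀ x y → (x , y) ∈ₚ pointSet S → P x y
pointSet-elim {m} S {P} P-ij x y a∈ with x <? m | y <? m
... | yes x<m | yes y<m = subst₂ P (toℕ-fromℕ< x<m) (toℕ-fromℕ< y<m) (P-ij _ _ a∈)

pointSet-inBox : ∀ {m} (S : Grid m) → InBox m m (pointSet S)
pointSet-inBox S = pointSet-elim S λ i j _ → toℕ<n i , toℕ<n j

grid-lookup : ∀ {m} f (i j : Fin m) → lookup (lookup (grid f) i) j ≡ f (toℕ i) (toℕ j)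
grid-lookup f i j =
  trans (cong (λ row → lookup row j) (lookup∘tabulate (λ i → tabulate λ j → f (toℕ i) (toℕ j)) i))
        (lookup∘tabulate (λ j → f (toℕ i) (toℕ j)) j)

grid-pointSet : ∀ {m} (S : Grid m) → grid (pointSet S) ≡ S
grid-pointSet S =
  trans (tabulate-cong λ i → trans (tabulate-cong λ j → pointSet-toℕ S i j) (tabulate∘lookup (lookup S i)))
        (tabulate∘lookup S)

pointSet-grid : ∀ {m f} → InBox m m f → pointSet {m} (grid f) ≐ f
pointSet-grid {m} {f} bx x y with x <? m | y <? m
... | yes x<m | yes y<m rewrite grid-lookup f (fromℕ< x<m) (fromℕ< y<m) | toℕ-fromℕ< x<m | toℕ-fromℕ< y<m = refl
... | yes _   | no y≮m  = sym (¬-not (y≮m ∘ proj₂ ∘ bx x y))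
... | no x≮m  | _       = sym (¬-not (x≮m ∘ proj₁ ∘ bx x y))

grid-cong : ∀ {m f g} → f ≐ g → grid {m} f ≡ grid g
grid-cong f≐g = tabulate-cong λ i → tabulate-cong λ j → f≐g _ _

pointSet-antichain : ∀ {m} (S : Grid m) → IsAntichain S → IsAntichainₚ (pointSet S)
pointSet-antichain S ac (x , y) (x′ , y′) =
  pointSet-elim S (λ i j ij∈ → pointSet-elim S (λ i′ j′ ij′∈ ne →
    ac (i , j) (i′ , j′) ij∈ ij′∈ (ne ∘ cong (λ (u , v) → toℕ u , toℕ v))) x′ y′) x y

antichain-of-pointSet : ∀ {m} (S : Grid m) → IsAntichainₚ (pointSet S) → IsAntichain S
antichain-of-pointSet S ac (i , j) (i′ , j′) ij∈ ij′∈ ne =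
  ac (toℕ i , toℕ j) (toℕ i′ , toℕ j′) (trans (pointSet-toℕ S i j) ij∈) (trans (pointSet-toℕ S i′ j′) ij′∈)
     (λ e → ne (cong₂ _,_ (toℕ-injective (cong proj₁ e)) (toℕ-injective (cong proj₂ e))))

pointSet-maximal : ∀ {m} (S : Grid m) → IsMaximalAntichain S → IsMaximalIn m m (pointSet S)
pointSet-maximal {m} S (ac , max) = isMaximalIn (pointSet-inBox S) (pointSet-antichain S ac) maxₚ
  where
  maxₚ : ∀ g → InBox m m g → IsAntichainₚ g → pointSet S ⊆ₚ g → g ⊆ₚ pointSet S
  maxₚ g bg ag sub (x , y) a∈ =
    pointSet-elim (grid g) (λ i j ij∈ → trans (pointSet-toℕ S i j) (max (grid g) acG S⊆ (i , j) ij∈))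
                  x y (trans (pointSet-grid bg x y) a∈)
    where
    acG : IsAntichain (grid {m} g)
    acG = antichain-of-pointSet (grid g) λ a b a∈ b∈ →
            ag a b (trans (sym (pointSet-grid bg _ _)) a∈) (trans (sym (pointSet-grid bg _ _)) b∈)
    S⊆ : S ⊆G grid g
    S⊆ (i , j) ij∈ = trans (grid-lookup g i j) (sub (toℕ i , toℕ j) (trans (pointSet-toℕ S i j) ij∈))

maximal-of-pointSet : ∀ {m} (S : Grid m) → IsMaximalIn m m (pointSet S) → IsMaximalAntichain S
maximal-of-pointSet S M = antichain-of-pointSet S antichain , max
  where
  open IsMaximalIn M
  max : ∀ T → IsAntichain T → S ⊆G T → T ⊆G S
  max T acT sub (i , j) ij∈ =
    trans (sym (pointSet-toℕ S i j))
          (maximal (pointSet T) (pointSet-inBox T) (pointSet-antichain T acT) S⊆ (toℕ i , toℕ j)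
                   (trans (pointSet-toℕ T i j) ij∈))
    where
    S⊆ : pointSet S ⊆ₚ pointSet T
    S⊆ (x , y) = pointSet-elim S (λ i j ij∈ → trans (pointSet-toℕ T i j) (sub (i , j) ij∈)) x y

axisStep : Bool → Step
axisStep true  = E
axisStep false = N

-- The number of letters b in w: moves b (axisStep d) is 1 exactly when d is b.
occurrences : Bool → List Bool → ℕ
occurrences b []      = 0
occurrences b (d ∷ w) = moves b (axisStep d) + occurrences b w

occurrences-same : ∀ d w → occurrences d (d ∷ w) ≡ suc (occurrences d w)
occurrences-same true  w = refl
occurrences-same false w = refl

occurrences-other : ∀ d w → occurrences (not d) (d ∷ w) ≡ occurrences (not d) w
occurrences-other true  w = refl
occurrences-other false w = refl

occurrences-length : ∀ w → occurrences true w + occurrences false w ≡ length w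
occurrences-length []          = refl
occurrences-length (true  ∷ w) = cong suc (occurrences-length w)
occurrences-length (false ∷ w) = trans (+-suc (occurrences true w) _) (cong suc (occurrences-length w))

turn : Maybe Bool → Bool → ℕ
turn (just true)  false = 1
turn (just false) true  = 1
turn _            _     = 0

turns : Maybe Bool → List Bool → ℕ
turns pr []      = 0
turns pr (d ∷ w) = turn pr d + turns (just d) w

occurrences-both : ∀ d w {n} → occurrences d w ≡ n → occurrences (not d) w ≡ n → ∀ b → occurrences b w ≡ n
occurrences-both true  w same other true  = same
occurrences-both true  w same other false = other
occurrences-both false w same other true  = other
occurrences-both false w same other false = same

fromRuns : Bool → List ℕ → List Bool
fromRuns d []       = []
fromRuns d (r ∷ rs) = replicate r d ++ fromRuns (not d) rs

-- runs d n w lists the run lengths of the word dⁿ w.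
runs : Bool → ℕ → List Bool → List ℕ
runs d     n []          = n ∷ []
runs true  n (true  ∷ w) = runs true (suc n) w
runs true  n (false ∷ w) = n ∷ runs false 1 w
runs false n (false ∷ w) = runs false (suc n) w
runs false n (true  ∷ w) = n ∷ runs true 1 w

runs-same : ∀ d n w → runs d n (d ∷ w) ≡ runs d (suc n) w
runs-same true  n w = refl
runs-same false n w = refl

runs-other : ∀ d n w → runs d n (not d ∷ w) ≡ n ∷ runs (not d) 1 w
runs-other true  n w = refl
runs-other false n w = refl

fromRuns-runs : ∀ d n w → fromRuns d (runs d n w) ≡ replicate n d ++ w
fromRuns-runs d     n []          = refl
fromRuns-runs true  n (true  ∷ w) = trans (fromRuns-runs true (suc n) w) (replicate-suc-++ n true w)
fromRuns-runs true  n (false ∷ w) = cong (replicate n true ++_) (fromRuns-runs false 1 w)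
fromRuns-runs false n (false ∷ w) = trans (fromRuns-runs false (suc n) w) (replicate-suc-++ n false w)
fromRuns-runs false n (true  ∷ w) = cong (replicate n false ++_) (fromRuns-runs true 1 w)

runs-positive : ∀ d n w → 1 ≤ n → Positive (runs d n w)
runs-positive d     n []          1≤n = 1≤n ∷ []
runs-positive true  n (true  ∷ w) 1≤n = runs-positive true (suc n) w (m≤n⇒m≤1+n 1≤n)
runs-positive true  n (false ∷ w) 1≤n = 1≤n ∷ runs-positive false 1 w ≤-refl
runs-positive false n (false ∷ w) 1≤n = runs-positive false (suc n) w (m≤n⇒m≤1+n 1≤n)
runs-positive false n (true  ∷ w) 1≤n = 1≤n ∷ runs-positive true 1 w ≤-refl

length-runs : ∀ d n w → length (runs d n w) ≡ suc (turns (just d) w)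
length-runs d     n []          = refl
length-runs true  n (true  ∷ w) = length-runs true (suc n) w
length-runs true  n (false ∷ w) = cong suc (length-runs false 1 w)
length-runs false n (false ∷ w) = length-runs false (suc n) w
length-runs false n (true  ∷ w) = cong suc (length-runs true 1 w)

sum-odds-evens-runs : ∀ d n w → sum (odds (runs d n w)) ≡ n + occurrences d w ×
                                sum (evens (runs d n w)) ≡ occurrences (not d) w
sum-odds-evens-runs d     n []          = refl , refl
sum-odds-evens-runs true  n (true  ∷ w) =
  let (o , e) = sum-odds-evens-runs true (suc n) w in trans o (sym (+-suc n _)) , e
sum-odds-evens-runs true  n (false ∷ w) =
  let (o , e) = sum-odds-evens-runs false 1 w in cong (n +_) e , o
sum-odds-evens-runs false n (false ∷ w) =
  let (o , e) = sum-odds-evens-runs false (suc n) w in trans o (sym (+-suc n _)) , e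
sum-odds-evens-runs false n (true  ∷ w) =
  let (o , e) = sum-odds-evens-runs true 1 w in cong (n +_) e , o

no-turns⇒no-other : ∀ d w → turns (just d) w ≡ 0 → occurrences (not d) w ≡ 0
no-turns⇒no-other d     []          _ = refl
no-turns⇒no-other true  (true  ∷ w) t≡0 = no-turns⇒no-other true w t≡0
no-turns⇒no-other false (false ∷ w) t≡0 = no-turns⇒no-other false w t≡0

runs-fromRuns : ∀ d n j rs → Positive rs → runs d n (replicate j d ++ fromRuns (not d) rs) ≡ (n + j) ∷ rs
runs-fromRuns d n (suc j) rs prs =
  trans (runs-same d n _) (trans (runs-fromRuns d (suc n) j rs prs) (cong (_∷ rs) (sym (+-suc n j))))
runs-fromRuns d n zero []             []         = cong (_∷ []) (sym (+-identityʳ n))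
runs-fromRuns d n zero (suc r ∷ rs) (_ ∷ prs) =
  trans (runs-other d n _) (cong₂ _∷_ (sym (+-identityʳ n)) (runs-fromRuns (not d) 1 r rs prs))

NoReversal : Maybe Bool → Path → Set
NoReversal (just true)  p = NoLeadingN p
NoReversal (just false) p = NoLeadingE p
NoReversal nothing      _ = ⊤

Compatible : Maybe Bool → ℕ → Path → Set
Compatible pr zero    p = NoReversal pr p
Compatible pr (suc _) _ = ⊤

-- The path D^g₀ s₁ D^g₁ … sₙ D^gₙ with sᵢ = axisStep wᵢ, except that one further D is put before
-- every sᵢ that turns, as validity demands; pr is the direction preceding w. The list of gaps gᵢ
-- is meant to have one entry more than w.
assemble : Maybe Bool → List Bool → List ℕ → Path
assemble pr []      (g ∷ _)  = replicate g D
assemble pr (d ∷ w) (g ∷ gs) = replicate (g + turn pr d) D ++ axisStep d ∷ assemble (just d) w gs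
assemble pr _       []       = []

disassemble : Maybe Bool → ℕ → Path → List Bool × List ℕ
disassemble pr n []      = [] , n ∷ []
disassemble pr n (D ∷ p) = disassemble pr (suc n) p
disassemble pr n (E ∷ p) = Product.map (true ∷_) (n ∸ turn pr true ∷_) (disassemble (just true) 0 p)
disassemble pr n (N ∷ p) = Product.map (false ∷_) (n ∸ turn pr false ∷_) (disassemble (just false) 0 p)

disassemble-Dⁿ : ∀ pr n j q → disassemble pr n (replicate j D ++ q) ≡ disassemble pr (j + n) q
disassemble-Dⁿ pr n zero    q = refl
disassemble-Dⁿ pr n (suc j) q = trans (disassemble-Dⁿ pr (suc n) j q) (cong (λ i → disassemble pr i q) (+-suc j n))

disassemble-axisStep : ∀ pr n d q → disassemble pr n (axisStep d ∷ q) ≡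
                       Product.map (d ∷_) (n ∸ turn pr d ∷_) (disassemble (just d) 0 q)
disassemble-axisStep pr n true  q = refl
disassemble-axisStep pr n false q = refl

disassemble-assemble : ∀ pr w gs → length gs ≡ suc (length w) → disassemble pr 0 (assemble pr w gs) ≡ (w , gs)
disassemble-assemble pr []      (g ∷ []) _ = begin
  disassemble pr 0 (replicate g D)       ≡⟨ cong (disassemble pr 0) (sym (++-identityʳ (replicate g D))) ⟩
  disassemble pr 0 (replicate g D ++ []) ≡⟨ disassemble-Dⁿ pr 0 g [] ⟩
  [] , g + 0 ∷ []                        ≡⟨ cong (λ i → [] , i ∷ []) (+-identityʳ g) ⟩
  [] , g ∷ []                            ∎
  where open ≡-Reasoning
disassemble-assemble pr (d ∷ w) (g ∷ gs) len≡ = begin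
  disassemble pr 0 (replicate (g + turn pr d) D ++ axisStep d ∷ assemble (just d) w gs)
    ≡⟨ disassemble-Dⁿ pr 0 (g + turn pr d) _ ⟩
  disassemble pr (g + turn pr d + 0) (axisStep d ∷ assemble (just d) w gs)
    ≡⟨ disassemble-axisStep pr _ d _ ⟩
  Product.map (d ∷_) (g + turn pr d + 0 ∸ turn pr d ∷_) (disassemble (just d) 0 (assemble (just d) w gs))
    ≡⟨ cong₂ (λ i r → Product.map (d ∷_) (i ∷_) r)
             (trans (cong (_∸ turn pr d) (+-identityʳ (g + turn pr d))) (m+n∸n≡m g (turn pr d)))
             (disassemble-assemble (just d) w gs (suc-injective len≡)) ⟩
  d ∷ w , g ∷ gs
    ∎
  where open ≡-Reasoning

length-disassemble : ∀ pr n p → length (proj₂ (disassemble pr n p)) ≡ suc (length (proj₁ (disassemble pr n p)))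
length-disassemble pr n []      = refl
length-disassemble pr n (D ∷ p) = length-disassemble pr (suc n) p
length-disassemble pr n (E ∷ p) = cong suc (length-disassemble (just true) 0 p)
length-disassemble pr n (N ∷ p) = cong suc (length-disassemble (just false) 0 p)

turn≤ : ∀ pr n d q → Compatible pr n (axisStep d ∷ q) → turn pr d ≤ n
turn≤ nothing      n       d     q _ = z≤n
turn≤ (just true)  n       true  q _ = z≤n
turn≤ (just false) n       false q _ = z≤n
turn≤ (just true)  (suc n) false q _ = s≤s z≤n
turn≤ (just false) (suc n) true  q _ = s≤s z≤n

assemble-disassemble : ∀ pr n p → Valid p → Compatible pr n p →
                       uncurry (assemble pr) (disassemble pr n p) ≡ replicate n D ++ p
assemble-disassemble pr n []      []       _ = sym (++-identityʳ (replicate n D))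
assemble-disassemble pr n (D ∷ p) (D∷ v)   _ =
  trans (assemble-disassemble pr (suc n) p v tt) (replicate-suc-++ n D p)
assemble-disassemble pr n (E ∷ p) (E∷ v nr) c =
  cong₂ (λ i q → replicate i D ++ E ∷ q) (m∸n+n≡m (turn≤ pr n true p c))
        (assemble-disassemble (just true) 0 p v nr)
assemble-disassemble pr n (N ∷ p) (N∷ v nr) c =
  cong₂ (λ i q → replicate i D ++ N ∷ q) (m∸n+n≡m (turn≤ pr n false p c))
        (assemble-disassemble (just false) 0 p v nr)

extent-Dⁿ : ∀ b n q → extent b (replicate n D ++ q) ≡ n + extent b q
extent-Dⁿ b zero    q = refl
extent-Dⁿ b (suc n) q = cong suc (extent-Dⁿ b n q)

extent-replicate-D : ∀ b n → extent b (replicate n D) ≡ n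
extent-replicate-D b zero    = refl
extent-replicate-D b (suc n) = cong suc (extent-replicate-D b n)

extent-assemble : ∀ b pr w gs → length gs ≡ suc (length w) →
                  extent b (assemble pr w gs) ≡ (sum gs + turns pr w) + occurrences b w
extent-assemble b pr []      (g ∷ []) _ =
  trans (cong (extent b) (sym (++-identityʳ (replicate g D)))) (trans (extent-Dⁿ b g []) (sym (trans (+-identityʳ _) (+-identityʳ _))))
extent-assemble b pr (d ∷ w) (g ∷ gs) len≡ = begin
  extent b (replicate (g + turn pr d) D ++ axisStep d ∷ assemble (just d) w gs)
    ≡⟨ extent-Dⁿ b (g + turn pr d) _ ⟩
  (g + turn pr d) + (moves b (axisStep d) + extent b (assemble (just d) w gs))
    ≡⟨ cong (λ e → (g + turn pr d) + (moves b (axisStep d) + e)) (extent-assemble b (just d) w gs (suc-injective len≡)) ⟩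
  (g + turn pr d) + (moves b (axisStep d) + ((sum gs + turns (just d) w) + occurrences b w))
    ≡⟨ regroup g (turn pr d) (moves b (axisStep d)) (sum gs) (turns (just d) w) (occurrences b w) ⟩
  ((g + sum gs) + (turn pr d + turns (just d) w)) + (moves b (axisStep d) + occurrences b w)
    ∎
  where
  open ≡-Reasoning
  regroup : ∀ g c e s t o → (g + c) + (e + ((s + t) + o)) ≡ ((g + s) + (c + t)) + (e + o)
  regroup = solve-∀

Dⁿ-valid : ∀ n {q} → Valid q → Valid (replicate n D ++ q)
Dⁿ-valid zero    v = v
Dⁿ-valid (suc n) v = D∷ Dⁿ-valid n v

noReversal-[] : ∀ pr → NoReversal pr []
noReversal-[] nothing      = tt
noReversal-[] (just true)  = tt
noReversal-[] (just false) = tt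

noReversal-D : ∀ pr q → NoReversal pr (D ∷ q)
noReversal-D nothing      q = tt
noReversal-D (just true)  q = tt
noReversal-D (just false) q = tt

noReversal-Dⁿ : ∀ pr n q → NoReversal pr q → NoReversal pr (replicate n D ++ q)
noReversal-Dⁿ pr zero    q nr = nr
noReversal-Dⁿ pr (suc n) q _  = noReversal-D pr _

noReversal-Dⁿ⁺¹ : ∀ pr n q → NoReversal pr (replicate (n + 1) D ++ q)
noReversal-Dⁿ⁺¹ pr n q rewrite +-comm n 1 = noReversal-D pr _

noReversal-turn : ∀ pr g d q → NoReversal pr (replicate (g + turn pr d) D ++ axisStep d ∷ q)
noReversal-turn nothing      g d     q = tt
noReversal-turn (just true)  g true  q = noReversal-Dⁿ (just true) (g + 0) (E ∷ q) tt
noReversal-turn (just false) g false q = noReversal-Dⁿ (just false) (g + 0) (N ∷ q) tt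
noReversal-turn (just true)  g false q = noReversal-Dⁿ⁺¹ (just true) g (N ∷ q)
noReversal-turn (just false) g true  q = noReversal-Dⁿ⁺¹ (just false) g (E ∷ q)

axisStep-valid : ∀ d {q} → Valid q → NoReversal (just d) q → Valid (axisStep d ∷ q)
axisStep-valid true  v nr = E∷ v nr
axisStep-valid false v nr = N∷ v nr

assemble-valid : ∀ pr w gs → Valid (assemble pr w gs) × NoReversal pr (assemble pr w gs)
assemble-valid pr []      (g ∷ _)  =
  subst (λ p → Valid p × NoReversal pr p) (++-identityʳ (replicate g D))
        (Dⁿ-valid g [] , noReversal-Dⁿ pr g [] (noReversal-[] pr))
assemble-valid pr (d ∷ w) (g ∷ gs) =
  let (v , nr) = assemble-valid (just d) w gs in
  Dⁿ-valid (g + turn pr d) (axisStep-valid d v nr) , noReversal-turn pr g d _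
assemble-valid pr []      []       = [] , noReversal-[] pr
assemble-valid pr (d ∷ w) []       = [] , noReversal-[] pr

-- Compositions

IsComposition : ℕ → ℕ → List ℕ → Set
IsComposition n p xs = Positive xs × length xs ≡ p × sum xs ≡ n

IsWeakComposition : ℕ → ℕ → List ℕ → Set
IsWeakComposition s g xs = length xs ≡ g × sum xs ≡ s

incHead : List ℕ → List ℕ
incHead []       = []
incHead (x ∷ xs) = suc x ∷ xs

incHead-injective : ∀ {xs ys : List ℕ} → incHead xs ≡ incHead ys → xs ≡ ys
incHead-injective {[]}     {[]}     _    = refl
incHead-injective {x ∷ xs} {y ∷ ys} refl = refl

compositions : ℕ → ℕ → List (List ℕ)
compositions zero    zero    = [] ∷ []
compositions zero    (suc p) = []
compositions (suc n) zero    = []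
compositions (suc n) (suc p) = map (1 ∷_) (compositions n p) ++ map incHead (compositions n (suc p))

weakCompositions : ℕ → ℕ → List (List ℕ)
weakCompositions zero    zero    = [] ∷ []
weakCompositions (suc s) zero    = []
weakCompositions zero    (suc g) = map (0 ∷_) (weakCompositions zero g)
weakCompositions (suc s) (suc g) = map (0 ∷_) (weakCompositions (suc s) g) ++ map incHead (weakCompositions s (suc g))

length-compositions : ∀ n p → length (compositions (suc n) (suc p)) ≡ n C p
length-compositions zero    zero    = refl
length-compositions zero    (suc p) = refl
length-compositions (suc n) zero    =
  trans (length-map-++-map (1 ∷_) incHead (compositions (suc n) zero) (compositions (suc n) 1))
        (length-compositions n zero)
length-compositions (suc n) (suc p) =
  trans (length-map-++-map (1 ∷_) incHead (compositions (suc n) (suc p)) (compositions (suc n) (suc (suc p))))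
        (trans (cong₂ _+_ (length-compositions n p) (length-compositions n (suc p))) (nCk+nC[k+1]≡[n+1]C[k+1] n p))

length-weakCompositions : ∀ s g → length (weakCompositions s (suc g)) ≡ (s + g) C s
length-weakCompositions zero    zero    = refl
length-weakCompositions zero    (suc g) =
  trans (length-map (0 ∷_) (weakCompositions zero (suc g))) (length-weakCompositions zero g)
length-weakCompositions (suc s) zero    =
  trans (length-map-++-map (0 ∷_) incHead (weakCompositions (suc s) zero) (weakCompositions s 1))
        (trans (length-weakCompositions s zero)
               (trans (cong (_C s) (+-identityʳ s))
                      (trans (nCn≡1 s) (sym (trans (cong (_C suc s) (+-identityʳ (suc s))) (nCn≡1 (suc s)))))))
length-weakCompositions (suc s) (suc g) =
  trans (length-map-++-map (0 ∷_) incHead (weakCompositions (suc s) (suc g)) (weakCompositions s (suc (suc g))))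
        (trans (cong₂ _+_ (length-weakCompositions (suc s) g) (length-weakCompositions s (suc g)))
               (trans (cong (λ n → n C suc s + (s + suc g) C s) (sym (+-suc s g)))
                      (trans (+-comm ((s + suc g) C suc s) ((s + suc g) C s))
                             (nCk+nC[k+1]≡[n+1]C[k+1] (s + suc g) s))))

∈-compositions⁻ : ∀ n p {xs} → xs ∈ compositions n p → IsComposition n p xs
∈-compositions⁻ zero    zero    (here refl) = [] , refl , refl
∈-compositions⁻ (suc n) (suc p) xs∈ with ∈-++⁻ (map (1 ∷_) (compositions n p)) xs∈
... | inj₁ xs∈₁ with ∈-map⁻ (1 ∷_) xs∈₁
...   | ys , ys∈ , refl = let (pos , len , sum≡) = ∈-compositions⁻ n p ys∈ in s≤s z≤n ∷ pos , cong suc len , cong suc sum≡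
∈-compositions⁻ (suc n) (suc p) xs∈ | inj₂ xs∈₂ with ∈-map⁻ incHead xs∈₂
...   | [] , ys∈ , refl with () ← proj₁ (proj₂ (∈-compositions⁻ n (suc p) ys∈))
...   | y ∷ ys , ys∈ , refl with _ ∷ pos , len , sum≡ ← ∈-compositions⁻ n (suc p) ys∈ =
  s≤s z≤n ∷ pos , len , cong suc sum≡

∈-compositions⁺ : ∀ n p {xs} → IsComposition n p xs → xs ∈ compositions n p
∈-compositions⁺ zero    zero    {[]}     _ = here refl
∈-compositions⁺ zero    p       {x ∷ xs} (px ∷ _ , _ , sum≡) = ⊥-elim (<⇒≢ (≤-trans px (m≤m+n x (sum xs))) (sym sum≡))
∈-compositions⁺ (suc n) (suc p) {suc zero ∷ xs} (_ ∷ pos , len , sum≡) =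
  ∈-++⁺ˡ (∈-map⁺ (1 ∷_) (∈-compositions⁺ n p (pos , suc-injective len , suc-injective sum≡)))
∈-compositions⁺ (suc n) (suc p) {suc (suc x) ∷ xs} (_ ∷ pos , len , sum≡) =
  ∈-++⁺ʳ (map (1 ∷_) (compositions n p))
         (∈-map⁺ incHead (∈-compositions⁺ n (suc p) (s≤s z≤n ∷ pos , len , suc-injective sum≡)))

∈-weakCompositions⁻ : ∀ s g {xs} → xs ∈ weakCompositions s g → IsWeakComposition s g xs
∈-weakCompositions⁻ zero    zero    (here refl) = refl , refl
∈-weakCompositions⁻ zero    (suc g) xs∈ with ∈-map⁻ (0 ∷_) xs∈
... | ys , ys∈ , refl = let (len , sum≡) = ∈-weakCompositions⁻ zero g ys∈ in cong suc len , sum≡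
∈-weakCompositions⁻ (suc s) (suc g) xs∈ with ∈-++⁻ (map (0 ∷_) (weakCompositions (suc s) g)) xs∈
... | inj₁ xs∈₁ with ∈-map⁻ (0 ∷_) xs∈₁
...   | ys , ys∈ , refl = let (len , sum≡) = ∈-weakCompositions⁻ (suc s) g ys∈ in cong suc len , sum≡
∈-weakCompositions⁻ (suc s) (suc g) xs∈ | inj₂ xs∈₂ with ∈-map⁻ incHead xs∈₂
...   | [] , ys∈ , refl with () ← proj₁ (∈-weakCompositions⁻ s (suc g) ys∈)
...   | y ∷ ys , ys∈ , refl = let (len , sum≡) = ∈-weakCompositions⁻ s (suc g) ys∈ in len , cong suc sum≡

∈-weakCompositions⁺ : ∀ s g {xs} → IsWeakComposition s g xs → xs ∈ weakCompositions s g
∈-weakCompositions⁺ zero    zero    {[]}          _            = here refl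
∈-weakCompositions⁺ zero    (suc g) {zero ∷ xs}   (len , sum≡) =
  ∈-map⁺ (0 ∷_) (∈-weakCompositions⁺ zero g (suc-injective len , sum≡))
∈-weakCompositions⁺ (suc s) (suc g) {zero ∷ xs}   (len , sum≡) =
  ∈-++⁺ˡ (∈-map⁺ (0 ∷_) (∈-weakCompositions⁺ (suc s) g (suc-injective len , sum≡)))
∈-weakCompositions⁺ (suc s) (suc g) {suc x ∷ xs}  (len , sum≡) =
  ∈-++⁺ʳ (map (0 ∷_) (weakCompositions (suc s) g))
         (∈-map⁺ incHead (∈-weakCompositions⁺ s (suc g) (len , suc-injective sum≡)))

compositions-unique : ∀ n p → Unique (compositions n p)
compositions-unique zero    zero    = [] ∷ []
compositions-unique zero    (suc p) = []
compositions-unique (suc n) zero    = []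
compositions-unique (suc n) (suc p) =
  Unique.++⁺ (Unique.map⁺ ∷-injectiveʳ (compositions-unique n p))
             (Unique.map⁺ incHead-injective (compositions-unique n (suc p))) disjoint
  where
  disjoint : ∀ {xs} → ¬ (xs ∈ map (1 ∷_) (compositions n p) × xs ∈ map incHead (compositions n (suc p)))
  disjoint (xs∈₁ , xs∈₂) with ∈-map⁻ (1 ∷_) xs∈₁ | ∈-map⁻ incHead xs∈₂
  ... | _ , _ , refl | zero ∷ _ , ys∈ , refl with () ∷ _ ← proj₁ (∈-compositions⁻ n (suc p) ys∈)

weakCompositions-unique : ∀ s g → Unique (weakCompositions s g)
weakCompositions-unique zero    zero    = [] ∷ []
weakCompositions-unique (suc s) zero    = []
weakCompositions-unique zero    (suc g) = Unique.map⁺ ∷-injectiveʳ (weakCompositions-unique zero g)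
weakCompositions-unique (suc s) (suc g) =
  Unique.++⁺ (Unique.map⁺ ∷-injectiveʳ (weakCompositions-unique (suc s) g))
             (Unique.map⁺ incHead-injective (weakCompositions-unique s (suc g))) disjoint
  where
  disjoint : ∀ {xs} → ¬ (xs ∈ map (0 ∷_) (weakCompositions (suc s) g) × xs ∈ map incHead (weakCompositions s (suc g)))
  disjoint (xs∈₁ , xs∈₂) with ∈-map⁻ (0 ∷_) xs∈₁ | ∈-map⁻ incHead xs∈₂
  ... | _ , _ , refl | [] , _ , ()

data Code : Set where
  diagonal : Code
  turning  : (d : Bool) (k t : ℕ) (c₁ c₂ gaps : List ℕ) → Code

decode : ℕ → Code → Path
decode m diagonal                   = replicate m D
decode m (turning d k t c₁ c₂ gaps) = assemble nothing (fromRuns d (interleave c₁ c₂)) gaps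

codeOfWord : List Bool → List ℕ → Code
codeOfWord []      gaps = diagonal
codeOfWord (d ∷ w) gaps =
  turning d (sum gaps + turns (just d) w) (turns (just d) w) (odds (runs d 1 w)) (evens (runs d 1 w)) gaps

encode : Path → Code
encode = uncurry codeOfWord ∘ disassemble nothing 0

-- k counts the D steps and t the turns; c₁ and c₂ are the odd and the even runs of the word of E and
-- N steps, and gaps lists the numbers of D steps around its letters beyond those forced by turns.
record TurningShape (m k t : ℕ) (c₁ c₂ gaps : List ℕ) : Set where
  field
    1≤t       : 1 ≤ t
    t≤k       : t ≤ k
    k<m       : k < m
    odd-runs  : IsComposition (m ∸ k) (suc ⌊ t /2⌋) c₁
    even-runs : IsComposition (m ∸ k) ⌈ t /2⌉ c₂
    gap-sizes : IsWeakComposition (k ∸ t) (suc (2 * (m ∸ k))) gaps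

WellFormed : ℕ → Code → Set
WellFormed m diagonal                   = ⊤
WellFormed m (turning d k t c₁ c₂ gaps) = TurningShape m k t c₁ c₂ gaps

record TurningWord (m k t : ℕ) (d : Bool) (c₁ c₂ : List ℕ) (w : List Bool) : Set where
  field
    odds≡        : odds (runs d 1 w) ≡ c₁
    evens≡       : evens (runs d 1 w) ≡ c₂
    turns≡       : turns (just d) w ≡ t
    occurrences≡ : ∀ b → occurrences b (d ∷ w) ≡ m ∸ k

turningWord : ∀ {m k t c₁ c₂ gaps} d w → TurningShape m k t c₁ c₂ gaps → runs d 1 w ≡ interleave c₁ c₂ →
              TurningWord m k t d c₁ c₂ w
turningWord {m} {k} {t} {c₁} {c₂} d w shape runs≡ = record
  { odds≡        = trans (cong odds runs≡) (proj₁ odds-evens)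
  ; evens≡       = trans (cong evens runs≡) (proj₂ odds-evens)
  ; turns≡       = suc-injective (begin
      suc (turns (just d) w)     ≡⟨ sym (length-runs d 1 w) ⟩
      length (runs d 1 w)        ≡⟨ cong length runs≡ ⟩
      length (interleave c₁ c₂)  ≡⟨ length-interleave c₁ c₂ ⟩
      length c₁ + length c₂      ≡⟨ cong₂ _+_ len₁ len₂ ⟩
      suc ⌊ t /2⌋ + ⌈ t /2⌉       ≡⟨ cong suc (⌊n/2⌋+⌈n/2⌉≡n t) ⟩
      suc t                      ∎)
  ; occurrences≡ = occurrences-both d (d ∷ w) same other
  }
  where
  open ≡-Reasoning
  open TurningShape shape
  len₁ = proj₁ (proj₂ odd-runs)
  len₂ = proj₁ (proj₂ even-runs)
  odds-evens = odds-evens-interleave c₁ c₂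
    (subst₂ _≤_ (sym len₂) (sym len₁) (⌈n/2⌉≤1+⌊n/2⌋ t))
    (subst₂ _≤_ (sym len₁) (cong suc (sym len₂)) (s≤s (⌊n/2⌋≤⌈n/2⌉ t)))
  same : occurrences d (d ∷ w) ≡ m ∸ k
  same = begin
    occurrences d (d ∷ w)       ≡⟨ occurrences-same d w ⟩
    1 + occurrences d w         ≡⟨ sym (proj₁ (sum-odds-evens-runs d 1 w)) ⟩
    sum (odds (runs d 1 w))     ≡⟨ cong sum (trans (cong odds runs≡) (proj₁ odds-evens)) ⟩
    sum c₁                      ≡⟨ proj₂ (proj₂ odd-runs) ⟩
    m ∸ k                       ∎
  other : occurrences (not d) (d ∷ w) ≡ m ∸ k
  other = begin
    occurrences (not d) (d ∷ w) ≡⟨ occurrences-other d w ⟩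
    occurrences (not d) w       ≡⟨ sym (proj₂ (sum-odds-evens-runs d 1 w)) ⟩
    sum (evens (runs d 1 w))    ≡⟨ cong sum (trans (cong evens runs≡) (proj₂ odds-evens)) ⟩
    sum c₂                      ≡⟨ proj₂ (proj₂ even-runs) ⟩
    m ∸ k                       ∎

square-assemble : ∀ {m k} w gaps → sum gaps + turns nothing w ≡ k → k ≤ m →
                  (∀ b → occurrences b w ≡ m ∸ k) → length gaps ≡ suc (length w) →
                  IsSquarePath m (assemble nothing w gaps)
square-assemble {m} {k} w gaps k≡ k≤m occ≡ len≡ =
  isSquarePath (proj₁ (assemble-valid nothing w gaps)) (extent≡ true) (extent≡ false)
  where
  extent≡ : ∀ b → extent b (assemble nothing w gaps) ≡ m
  extent≡ b = trans (extent-assemble b nothing w gaps len≡) (trans (cong₂ _+_ k≡ (occ≡ b)) (m+[n∸m]≡n k≤m))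

decode-turning : ∀ {m k t c₁ c₂ gaps} d → TurningShape m k t c₁ c₂ gaps →
                 IsSquarePath m (decode m (turning d k t c₁ c₂ gaps)) ×
                 encode (decode m (turning d k t c₁ c₂ gaps)) ≡ turning d k t c₁ c₂ gaps
decode-turning {c₁ = []}       d shape with () ← proj₁ (proj₂ (TurningShape.odd-runs shape))
decode-turning {c₁ = zero ∷ _} d shape with () ∷ _ ← proj₁ (TurningShape.odd-runs shape)
decode-turning {m} {k} {t} {suc x ∷ c₁′} {c₂} {gaps} d shape =
  square-assemble (d ∷ w) gaps k≡ (<⇒≤ k<m) occurrences≡ len≡ , encode≡
  where
  open TurningShape shape
  w = replicate x d ++ fromRuns (not d) (interleave c₂ c₁′)
  word : TurningWord m k t d (suc x ∷ c₁′) c₂ w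
  word = turningWord d w shape
    (runs-fromRuns d 1 x _ (All.tail (interleave-positive _ c₂ (proj₁ odd-runs) (proj₁ even-runs))))
  open TurningWord word
  k≡ : sum gaps + turns (just d) w ≡ k
  k≡ = trans (cong₂ _+_ (proj₂ gap-sizes) turns≡) (m∸n+n≡m t≤k)
  len≡ : length gaps ≡ suc (length (d ∷ w))
  len≡ = trans (proj₁ gap-sizes) (cong suc (begin
    2 * (m ∸ k)                                       ≡⟨ cong ((m ∸ k) +_) (+-identityʳ (m ∸ k)) ⟩
    (m ∸ k) + (m ∸ k)                                 ≡⟨ cong₂ _+_ (sym (occurrences≡ true)) (sym (occurrences≡ false)) ⟩
    occurrences true (d ∷ w) + occurrences false (d ∷ w) ≡⟨ occurrences-length (d ∷ w) ⟩
    length (d ∷ w)                                    ∎))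
    where open ≡-Reasoning
  encode≡ : encode (assemble nothing (d ∷ w) gaps) ≡ turning d k t (suc x ∷ c₁′) c₂ gaps
  encode≡ = trans (cong (uncurry codeOfWord) (disassemble-assemble nothing (d ∷ w) gaps len≡))
                  (trans (cong₂ (λ k t → turning d k t (odds (runs d 1 w)) (evens (runs d 1 w)) gaps) k≡ turns≡)
                         (cong₂ (λ c₁ c₂ → turning d k t c₁ c₂ gaps) odds≡ evens≡))

decode-wellFormed : ∀ m c → WellFormed m c → IsSquarePath m (decode m c) × encode (decode m c) ≡ c
decode-wellFormed m diagonal                   _     =
  square-assemble [] (m ∷ []) (trans (+-identityʳ _) (+-identityʳ m)) ≤-refl (λ _ → sym (n∸n≡0 m)) refl ,
  cong (uncurry codeOfWord) (disassemble-assemble nothing [] (m ∷ []) refl)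
decode-wellFormed m (turning d k t c₁ c₂ gaps) shape = decode-turning d shape

codeOfWord-wellFormed : ∀ m d w gaps → length gaps ≡ suc (length (d ∷ w)) →
                        IsSquarePath m (assemble nothing (d ∷ w) gaps) → WellFormed m (codeOfWord (d ∷ w) gaps)
codeOfWord-wellFormed m d w gaps len≡ sq = record
  { 1≤t       = 1≤t
  ; t≤k       = m≤n+m t (sum gaps)
  ; k<m       = k<m
  ; odd-runs  = proj₁ odds-evens-pos , trans (proj₁ (length-odds-evens r)) (cong ⌈_/2⌉ (length-runs d 1 w)) , odd-sum
  ; even-runs = proj₂ odds-evens-pos , trans (proj₂ (length-odds-evens r)) (cong ⌊_/2⌋ (length-runs d 1 w)) , even-sum
  ; gap-sizes = trans len≡ (cong suc word-length) , sym (m+n∸n≡m (sum gaps) t)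
  }
  where
  open IsSquarePath sq
  t = turns (just d) w
  k = sum gaps + t
  r = runs d 1 w
  k+occ≡m : ∀ b → k + occurrences b (d ∷ w) ≡ m
  k+occ≡m true  = trans (sym (extent-assemble true nothing (d ∷ w) gaps len≡)) width≡
  k+occ≡m false = trans (sym (extent-assemble false nothing (d ∷ w) gaps len≡)) height≡
  occ≡ : ∀ b → occurrences b (d ∷ w) ≡ m ∸ k
  occ≡ b = trans (sym (m+n∸m≡n k _)) (cong (_∸ k) (k+occ≡m b))
  word-length : length (d ∷ w) ≡ 2 * (m ∸ k)
  word-length = trans (sym (occurrences-length (d ∷ w)))
                      (trans (cong₂ _+_ (occ≡ true) (occ≡ false)) (cong ((m ∸ k) +_) (sym (+-identityʳ (m ∸ k)))))
  1≤m∸k : 1 ≤ m ∸ k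
  1≤m∸k with m ∸ k | word-length
  ... | suc _ | _ = s≤s z≤n
  k<m : k < m
  k<m = ≰⇒> λ m≤k → <⇒≱ 1≤m∸k (≤-reflexive (m≤n⇒m∸n≡0 m≤k))
  1≤t : 1 ≤ t
  1≤t = ≰⇒> λ t≤0 → <⇒≱ 1≤m∸k (≤-reflexive (begin
    m ∸ k                       ≡⟨ sym (occ≡ (not d)) ⟩
    occurrences (not d) (d ∷ w) ≡⟨ occurrences-other d w ⟩
    occurrences (not d) w       ≡⟨ no-turns⇒no-other d w (n≤0⇒n≡0 t≤0) ⟩
    0                           ∎))
    where open ≡-Reasoning
  odds-evens-pos = odds-evens-positive r (runs-positive d 1 w ≤-refl)
  odd-sum : sum (odds r) ≡ m ∸ k
  odd-sum = trans (proj₁ (sum-odds-evens-runs d 1 w)) (trans (sym (occurrences-same d w)) (occ≡ d))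
  even-sum : sum (evens r) ≡ m ∸ k
  even-sum = trans (proj₂ (sum-odds-evens-runs d 1 w)) (trans (sym (occurrences-other d w)) (occ≡ (not d)))

codeOfWord-square : ∀ m w gaps → length gaps ≡ suc (length w) → IsSquarePath m (assemble nothing w gaps) →
                    WellFormed m (codeOfWord w gaps) × decode m (codeOfWord w gaps) ≡ assemble nothing w gaps
codeOfWord-square m []      (g ∷ []) _    sq =
  tt , cong (λ n → replicate n D) (trans (sym (IsSquarePath.width≡ sq)) (extent-replicate-D true g))
codeOfWord-square m (d ∷ w) gaps     len≡ sq =
  codeOfWord-wellFormed m d w gaps len≡ sq ,
  cong (λ w → assemble nothing w gaps)
       (trans (cong (fromRuns d) (interleave-odds-evens (runs d 1 w))) (fromRuns-runs d 1 w))

encode-square : ∀ m p → IsSquarePath m p → WellFormed m (encode p) × decode m (encode p) ≡ p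
encode-square m p sq =
  let (wf , decode≡) = codeOfWord-square m w gaps (length-disassemble nothing 0 p) (subst (IsSquarePath m) (sym p≡) sq)
  in wf , trans decode≡ p≡
  where
  w    = proj₁ (disassemble nothing 0 p)
  gaps = proj₂ (disassemble nothing 0 p)
  p≡ : assemble nothing w gaps ≡ p
  p≡ = assemble-disassemble nothing 0 p (IsSquarePath.valid sq) tt

-- The split point of the formula: for k ≤ L m the turns are bounded by k, beyond it by 2m ∸ 2k ∸ 1.
L : ℕ → ℕ
L m = (2 * m ∸ 1) / 3

≤L⇒*3≤ : ∀ m {k} → k ≤ L m → k * 3 ≤ 2 * m ∸ 1
≤L⇒*3≤ m k≤L = ≤-trans (*-monoˡ-≤ 3 k≤L) (m/n*n≤m (2 * m ∸ 1) 3)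

*3≤⇒≤L : ∀ m {k} → k * 3 ≤ 2 * m ∸ 1 → k ≤ L m
*3≤⇒≤L m {k} k*3≤ = subst (_≤ L m) (m*n/n≡m k 3) (/-monoˡ-≤ 3 k*3≤)

≤L⇒<m : ∀ m {k} → 1 ≤ k → k ≤ L m → k < m
≤L⇒<m m {k} 1≤k k≤L = ≰⇒> λ m≤k → <⇒≱ (begin-strict
  2 * m ∸ 1 ≤⟨ m∸n≤m (2 * m) 1 ⟩
  2 * m     ≤⟨ *-monoʳ-≤ 2 m≤k ⟩
  2 * k     <⟨ m<m+n (2 * k) 1≤k ⟩
  2 * k + k ≡⟨ 2k+k≡k*3 k ⟩
  k * 3     ∎) (≤L⇒*3≤ m k≤L)
  where open ≤-Reasoning

L<⇒≤ : ∀ m {k t} → L m < k → t ≤ 2 * m ∸ 2 * k ∸ 1 → t ≤ k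
L<⇒≤ m {k} {t} L<k t≤ = ≤-trans t≤ (≤-trans (m∸n≤m _ 1) (m≤n+o⇒m∸n≤o (2 * m) (2 * k) 2m≤))
  where
  open ≤-Reasoning
  2m≤ : 2 * m ≤ 2 * k + k
  2m≤ = begin
    2 * m           ≤⟨ m≤n+m∸n (2 * m) 1 ⟩
    1 + (2 * m ∸ 1) ≤⟨ ≰⇒> (λ k*3≤ → <⇒≱ L<k (*3≤⇒≤L m k*3≤)) ⟩
    k * 3           ≡⟨ sym (2k+k≡k*3 k) ⟩
    2 * k + k       ∎

codesWith : ℕ → Bool → ℕ → ℕ → List Code
codesWith m d k t =
  cartesianProductWith (λ c₁ (c₂ , gaps) → turning d k t c₁ c₂ gaps)
    (compositions (m ∸ k) (suc ⌊ t /2⌋))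
    (cartesianProduct (compositions (m ∸ k) ⌈ t /2⌉) (weakCompositions (k ∸ t) (suc (2 * (m ∸ k)))))

record InCodesWith (m : ℕ) (d : Bool) (k t : ℕ) (c : Code) : Set where
  field
    {c₁ c₂ gaps} : List ℕ
    code≡        : c ≡ turning d k t c₁ c₂ gaps
    odd-runs     : IsComposition (m ∸ k) (suc ⌊ t /2⌋) c₁
    even-runs    : IsComposition (m ∸ k) ⌈ t /2⌉ c₂
    gap-sizes    : IsWeakComposition (k ∸ t) (suc (2 * (m ∸ k))) gaps

∈-codesWith⁻ : ∀ {m d k t c} → c ∈ codesWith m d k t → InCodesWith m d k t c
∈-codesWith⁻ {m} {d} {k} {t} c∈
  with c₁ , (c₂ , gaps) , c₁∈ , c₂gaps∈ , refl
         ← ∈-cartesianProductWith⁻ (λ c₁ (c₂ , gaps) → turning d k t c₁ c₂ gaps) (compositions (m ∸ k) (suc ⌊ t /2⌋)) _ c∈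
  with c₂∈ , gaps∈ ← ∈-cartesianProduct⁻ (compositions (m ∸ k) ⌈ t /2⌉) _ c₂gaps∈ = record
  { code≡     = refl
  ; odd-runs  = ∈-compositions⁻ _ _ c₁∈
  ; even-runs = ∈-compositions⁻ _ _ c₂∈
  ; gap-sizes = ∈-weakCompositions⁻ _ _ gaps∈
  }

∈-codesWith⁺ : ∀ {m d k t c₁ c₂ gaps} → TurningShape m k t c₁ c₂ gaps → turning d k t c₁ c₂ gaps ∈ codesWith m d k t
∈-codesWith⁺ shape =
  ∈-cartesianProductWith⁺ _ (∈-compositions⁺ _ _ odd-runs)
    (∈-cartesianProduct⁺ (∈-compositions⁺ _ _ even-runs) (∈-weakCompositions⁺ _ _ gap-sizes))
  where open TurningShape shape

codesWith-unique : ∀ m d k t → Unique (codesWith m d k t)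
codesWith-unique m d k t =
  Unique.cartesianProductWith⁺ _ (λ { refl → refl , refl }) (compositions-unique (m ∸ k) (suc ⌊ t /2⌋))
    (Unique.cartesianProduct⁺ (compositions-unique (m ∸ k) ⌈ t /2⌉)
                              (weakCompositions-unique (k ∸ t) (suc (2 * (m ∸ k)))))

length-codesWith : ∀ m d k t → 1 ≤ t → t ≤ k → k < m → length (codesWith m d k t) ≡ term m k t
length-codesWith m d k (suc t′) 1≤t t≤k k<m = begin
  length (codesWith m d k t)
    ≡⟨ length-cartesianProductWith _ (compositions (m ∸ k) (suc ⌊ t /2⌋)) _ ⟩
  length (compositions (m ∸ k) (suc ⌊ t /2⌋)) * length (cartesianProduct C₂ W)
    ≡⟨ cong (length (compositions (m ∸ k) (suc ⌊ t /2⌋)) *_) (length-cartesianProductWith _,_ C₂ W) ⟩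
  length (compositions (m ∸ k) (suc ⌊ t /2⌋)) * (length C₂ * length W)
    ≡⟨ cong₂ (λ n o → n * (o * length W)) (length-compositions′ ⌊ t /2⌋) (length-compositions′ ⌊ t′ /2⌋) ⟩
  (n C ⌊ t /2⌋) * ((n C ⌊ t′ /2⌋) * length W)
    ≡⟨ cong₂ (λ i j → (n C i) * ((n C j) * length W)) (⌊n/2⌋≡n/2 t) (⌊n/2⌋≡n/2 t′) ⟩
  (n C (t / 2)) * ((n C (t′ / 2)) * length W)
    ≡⟨ sym (*-assoc (n C (t / 2)) _ _) ⟩
  (n C (t / 2)) * (n C (t′ / 2)) * length W
    ≡⟨ cong ((n C (t / 2)) * (n C (t′ / 2)) *_) length-W ⟩
  term m k t ∎
  where
  open ≡-Reasoning
  t = suc t′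
  n = m ∸ k ∸ 1
  C₂ = compositions (m ∸ k) ⌈ t /2⌉
  W  = weakCompositions (k ∸ t) (suc (2 * (m ∸ k)))
  length-compositions′ : ∀ p → length (compositions (m ∸ k) (suc p)) ≡ n C p
  length-compositions′ p rewrite n≡1+[n∸1] (m+n≤o⇒m≤o∸n 1 k<m) = length-compositions n p
  length-W : length W ≡ (2 * m ∸ k ∸ t) C (k ∸ t)
  length-W = trans (length-weakCompositions (k ∸ t) (2 * (m ∸ k)))
                   (cong (_C (k ∸ t)) (sym (2m∸k∸t≡[k∸t]+2[m∸k] t≤k (<⇒≤ k<m))))

-- Labels telling the blocks of the enumeration apart; their values at diagonal are never used.
dStepsOf turnsOf : Code → ℕ
dStepsOf diagonal              = 0
dStepsOf (turning _ k _ _ _ _) = k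
turnsOf  diagonal              = 0
turnsOf  (turning _ _ t _ _ _) = t

IsTurning : Bool → Code → Set
IsTurning d diagonal               = ⊥
IsTurning d (turning d′ _ _ _ _ _) = d′ ≡ d

codesInRange : ℕ → Bool → ℕ → ℕ → (ℕ → ℕ) → List Code
codesInRange m d kmin kmax tmax = concatRange kmin kmax λ k → concatRange 1 (tmax k) (codesWith m d k)

lowCodes highCodes turningCodes : ℕ → Bool → List Code
lowCodes     m d = codesInRange m d 1 (L m) (λ k → k)
highCodes    m d = codesInRange m d (suc (L m)) (m ∸ 1) (λ k → 2 * m ∸ 2 * k ∸ 1)
turningCodes m d = lowCodes m d ++ highCodes m d

codes : ℕ → List Code
codes m = diagonal ∷ (turningCodes m true ++ turningCodes m false)

∈-codesInRange⁻ : ∀ {m d kmin kmax tmax c} → c ∈ codesInRange m d kmin kmax tmax →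
                  Σ[ k ∈ ℕ ] Σ[ t ∈ ℕ ] kmin ≤ k × k ≤ kmax × 1 ≤ t × t ≤ tmax k × InCodesWith m d k t c
∈-codesInRange⁻ {m} {d} {kmin} {kmax} {tmax} c∈
  with k , kmin≤k , k≤kmax , c∈′ ← ∈-concatRange⁻ kmin kmax _ c∈
  with t , 1≤t , t≤tmax , c∈″ ← ∈-concatRange⁻ 1 (tmax k) _ c∈′ =
  k , t , kmin≤k , k≤kmax , 1≤t , t≤tmax , ∈-codesWith⁻ c∈″

codesInRange-unique : ∀ m d kmin kmax tmax → Unique (codesInRange m d kmin kmax tmax)
codesInRange-unique m d kmin kmax tmax =
  concatRange-unique kmin kmax (λ k → concatRange 1 (tmax k) (codesWith m d k)) dStepsOf
    (λ k → concatRange-unique 1 (tmax k) (codesWith m d k) turnsOf (codesWith-unique m d k)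
             (λ t c∈ → cong turnsOf (InCodesWith.code≡ (∈-codesWith⁻ {m} {d} {k} {t} c∈))))
    (λ k c∈ → let (t , _ , _ , c∈′) = ∈-concatRange⁻ 1 (tmax k) (codesWith m d k) c∈ in
              cong dStepsOf (InCodesWith.code≡ (∈-codesWith⁻ {m} {d} {k} {t} c∈′)))

length-codesInRange : ∀ m d kmin kmax tmax → (∀ {k t} → kmin ≤ k → k ≤ kmax → 1 ≤ t → t ≤ tmax k → t ≤ k × k < m) →
                      length (codesInRange m d kmin kmax tmax) ≡ sumRange kmin kmax (λ k → sumRange 1 (tmax k) (term m k))
length-codesInRange m d kmin kmax tmax bounds =
  length-concatRange kmin kmax (λ k → concatRange 1 (tmax k) (codesWith m d k)) _ λ k kmin≤k k≤kmax →
    length-concatRange 1 (tmax k) (codesWith m d k) (term m k) λ t 1≤t t≤tmax →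
      let (t≤k , k<m) = bounds kmin≤k k≤kmax 1≤t t≤tmax in length-codesWith m d k t 1≤t t≤k k<m

inCodesWith-wellFormed : ∀ {m d k t c} → 1 ≤ t → t ≤ k → k < m → InCodesWith m d k t c →
                         WellFormed m c × IsTurning d c
inCodesWith-wellFormed {m} {d} 1≤t t≤k k<m I =
  subst (λ c → WellFormed m c × IsTurning d c) (sym code≡)
        (record { 1≤t = 1≤t ; t≤k = t≤k ; k<m = k<m ; odd-runs = odd-runs ; even-runs = even-runs
                ; gap-sizes = gap-sizes }
        , refl)
  where open InCodesWith I

turns≤2m∸2k∸1 : ∀ {m k t c₁ c₂ gaps} → TurningShape m k t c₁ c₂ gaps → t ≤ 2 * m ∸ 2 * k ∸ 1
turns≤2m∸2k∸1 {m} {k} {t} {c₁} {c₂} shape = m+n≤o⇒m≤o∸n t (begin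
  t + 1                    ≡⟨ +-comm t 1 ⟩
  suc t                    ≡⟨ cong suc (sym (⌊n/2⌋+⌈n/2⌉≡n t)) ⟩
  suc ⌊ t /2⌋ + ⌈ t /2⌉     ≡⟨ sym (cong₂ _+_ (proj₁ (proj₂ odd-runs)) (proj₁ (proj₂ even-runs))) ⟩
  length c₁ + length c₂    ≤⟨ +-mono-≤ (positive-length≤sum c₁ (proj₁ odd-runs)) (positive-length≤sum c₂ (proj₁ even-runs)) ⟩
  sum c₁ + sum c₂          ≡⟨ cong₂ _+_ (proj₂ (proj₂ odd-runs)) (proj₂ (proj₂ even-runs)) ⟩
  (m ∸ k) + (m ∸ k)        ≡⟨ cong ((m ∸ k) +_) (sym (+-identityʳ (m ∸ k))) ⟩
  2 * (m ∸ k)              ≡⟨ *-distribˡ-∸ 2 m k ⟩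
  2 * m ∸ 2 * k            ∎)
  where
  open ≤-Reasoning
  open TurningShape shape

low-bounds : ∀ {m k t} → 1 ≤ k → k ≤ L m → 1 ≤ t → t ≤ k → t ≤ k × k < m
low-bounds {m} 1≤k k≤L _ t≤k = t≤k , ≤L⇒<m m 1≤k k≤L

high-bounds : ∀ {m k t} → suc (L m) ≤ k → k ≤ m ∸ 1 → 1 ≤ t → t ≤ 2 * m ∸ 2 * k ∸ 1 → t ≤ k × k < m
high-bounds {m} L<k k≤m∸1 _ t≤ = L<⇒≤ m L<k t≤ , ≤m∸1⇒< (≤-<-trans z≤n L<k) k≤m∸1

∈-lowCodes⁻ : ∀ {m d c} → c ∈ lowCodes m d → dStepsOf c ≤ L m × WellFormed m c × IsTurning d c
∈-lowCodes⁻ {m} {d} c∈ with k , t , 1≤k , k≤L , 1≤t , t≤k , I ← ∈-codesInRange⁻ c∈ =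
  subst (_≤ L m) (sym (cong dStepsOf (InCodesWith.code≡ I))) k≤L ,
  inCodesWith-wellFormed 1≤t t≤k (proj₂ (low-bounds {m} 1≤k k≤L 1≤t t≤k)) I

∈-highCodes⁻ : ∀ {m d c} → c ∈ highCodes m d → L m < dStepsOf c × WellFormed m c × IsTurning d c
∈-highCodes⁻ {m} {d} c∈ with k , t , L<k , k≤m∸1 , 1≤t , t≤ , I ← ∈-codesInRange⁻ c∈ =
  subst (L m <_) (sym (cong dStepsOf (InCodesWith.code≡ I))) L<k ,
  let (t≤k , k<m) = high-bounds {m} L<k k≤m∸1 1≤t t≤ in inCodesWith-wellFormed 1≤t t≤k k<m I

∈-turningCodes⁻ : ∀ {m d c} → c ∈ turningCodes m d → WellFormed m c × IsTurning d c
∈-turningCodes⁻ {m} {d} c∈ with ∈-++⁻ (lowCodes m d) c∈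
... | inj₁ c∈low  = proj₂ (∈-lowCodes⁻ {m} c∈low)
... | inj₂ c∈high = proj₂ (∈-highCodes⁻ {m} c∈high)

∈-turningCodes⁺ : ∀ {m d k t c₁ c₂ gaps} → TurningShape m k t c₁ c₂ gaps → turning d k t c₁ c₂ gaps ∈ turningCodes m d
∈-turningCodes⁺ {m} {d} {k} shape with k ≤? L m
... | yes k≤L = ∈-++⁺ˡ (∈-concatRange⁺ 1 (L m) (λ k → concatRange 1 k (codesWith m d k)) (≤-trans 1≤t t≤k) k≤L
                        (∈-concatRange⁺ 1 k (codesWith m d k) 1≤t t≤k (∈-codesWith⁺ shape)))
  where open TurningShape shape
... | no k≰L  = ∈-++⁺ʳ (lowCodes m d)
                  (∈-concatRange⁺ (suc (L m)) (m ∸ 1) (λ k → concatRange 1 (2 * m ∸ 2 * k ∸ 1) (codesWith m d k))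
                                  (≰⇒> k≰L) (<⇒≤m∸1 k<m)
                     (∈-concatRange⁺ 1 (2 * m ∸ 2 * k ∸ 1) (codesWith m d k) 1≤t (turns≤2m∸2k∸1 shape) (∈-codesWith⁺ shape)))
  where open TurningShape shape

∈-codes⁻ : ∀ {m c} → c ∈ codes m → WellFormed m c
∈-codes⁻     (here refl) = tt
∈-codes⁻ {m} (there c∈) with ∈-++⁻ (turningCodes m true) c∈
... | inj₁ c∈′ = proj₁ (∈-turningCodes⁻ {m} c∈′)
... | inj₂ c∈′ = proj₁ (∈-turningCodes⁻ {m} c∈′)

∈-codes⁺ : ∀ {m} c → WellFormed m c → c ∈ codes m
∈-codes⁺     diagonal                         _     = here refl
∈-codes⁺     (turning true  k t c₁ c₂ gaps) shape = there (∈-++⁺ˡ (∈-turningCodes⁺ shape))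
∈-codes⁺ {m} (turning false k t c₁ c₂ gaps) shape = there (∈-++⁺ʳ (turningCodes m true) (∈-turningCodes⁺ shape))

turningCodes-unique : ∀ m d → Unique (turningCodes m d)
turningCodes-unique m d =
  Unique.++⁺ (codesInRange-unique m d 1 (L m) (λ k → k))
             (codesInRange-unique m d (suc (L m)) (m ∸ 1) (λ k → 2 * m ∸ 2 * k ∸ 1))
             λ (c∈low , c∈high) → <⇒≱ (proj₁ (∈-highCodes⁻ {m} c∈high)) (proj₁ (∈-lowCodes⁻ {m} c∈low))

codes-unique : ∀ m → Unique (codes m)
codes-unique m =
  All.tabulate (λ c∈ → diagonal∉ (∈-++⁻ (turningCodes m true) c∈)) ∷
  Unique.++⁺ (turningCodes-unique m true) (turningCodes-unique m false) true-false-disjoint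
  where
  diagonal∉ : ∀ {c} → c ∈ turningCodes m true ⊎ c ∈ turningCodes m false → diagonal ≢ c
  diagonal∉ (inj₁ c∈) refl = proj₂ (∈-turningCodes⁻ {m} c∈)
  diagonal∉ (inj₂ c∈) refl = proj₂ (∈-turningCodes⁻ {m} c∈)
  true-false-disjoint : ∀ {c} → ¬ (c ∈ turningCodes m true × c ∈ turningCodes m false)
  true-false-disjoint {diagonal}           (c∈ , _)   = proj₂ (∈-turningCodes⁻ {m} c∈)
  true-false-disjoint {turning d _ _ _ _ _} (c∈ , c∈′) =
    case trans (sym (proj₂ (∈-turningCodes⁻ {m} c∈))) (proj₂ (∈-turningCodes⁻ {m} c∈′)) of λ ()

length-codes : ∀ m → length (codes m) ≡ formula m
length-codes m = cong suc (begin
  length (turningCodes m true ++ turningCodes m false)            ≡⟨ length-++ (turningCodes m true) ⟩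
  length (turningCodes m true) + length (turningCodes m false)    ≡⟨ cong₂ _+_ (length-turningCodes true) (length-turningCodes false) ⟩
  (S₁ + S₂) + (S₁ + S₂)                                            ≡⟨ regroup S₁ S₂ ⟩
  2 * S₁ + 2 * S₂                                                  ∎)
  where
  open ≡-Reasoning
  S₁ = sumRange 1 (L m) (λ k → sumRange 1 k (term m k))
  S₂ = sumRange (suc (L m)) (m ∸ 1) (λ k → sumRange 1 (2 * m ∸ 2 * k ∸ 1) (term m k))
  length-turningCodes : ∀ d → length (turningCodes m d) ≡ S₁ + S₂
  length-turningCodes d =
    trans (length-++ (lowCodes m d))
          (cong₂ _+_ (length-codesInRange m d 1 (L m) (λ k → k) (low-bounds {m}))
                     (length-codesInRange m d (suc (L m)) (m ∸ 1) (λ k → 2 * m ∸ 2 * k ∸ 1) (high-bounds {m})))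
  regroup : ∀ a b → (a + b) + (a + b) ≡ 2 * a + 2 * b
  regroup = solve-∀

gridOf : (m : ℕ) → Code → Grid m
gridOf m c = grid (points (decode m c))

gridOf-maximal : ∀ m c → WellFormed m c → IsMaximalAntichain (gridOf m c)
gridOf-maximal m c wf =
  maximal-of-pointSet (gridOf m c)
    (maximal-≐ (≐-sym (pointSet-grid (IsMaximalIn.inBox M))) M)
  where M = square-maximal (proj₁ (decode-wellFormed m c wf))

gridOf-injective : ∀ m {c c′} → WellFormed m c → WellFormed m c′ → gridOf m c ≡ gridOf m c′ → c ≡ c′
gridOf-injective m {c} {c′} wf wf′ eq = begin
  c                     ≡⟨ sym encode∘decode ⟩
  encode (decode m c)   ≡⟨ cong encode (points-injective _ _ (valid sq) (valid sq′) (trans (width≡ sq) (sym (width≡ sq′)))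
                                          (trans (height≡ sq) (sym (height≡ sq′))) points≐) ⟩
  encode (decode m c′)  ≡⟨ encode∘decode′ ⟩
  c′                    ∎
  where
  open ≡-Reasoning
  open IsSquarePath
  sq = proj₁ (decode-wellFormed m c wf)
  sq′ = proj₁ (decode-wellFormed m c′ wf′)
  encode∘decode = proj₂ (decode-wellFormed m c wf)
  encode∘decode′ = proj₂ (decode-wellFormed m c′ wf′)
  points≐ : points (decode m c) ≐ points (decode m c′)
  points≐ x y = trans (sym (pointSet-grid (IsMaximalIn.inBox (square-maximal sq)) x y))
                      (trans (cong (λ S → pointSet S x y) eq) (pointSet-grid (IsMaximalIn.inBox (square-maximal sq′)) x y))

maximal-gridOf : ∀ {m} (S : Grid m) → IsMaximalAntichain S → Σ[ c ∈ Code ] WellFormed m c × gridOf m c ≡ S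
maximal-gridOf {m} S mS = encode p , wf , (begin
  grid (points (decode m (encode p))) ≡⟨ cong (grid ∘ points) decode≡ ⟩
  grid (points p)                     ≡⟨ grid-cong points≐ ⟩
  grid (pointSet S)                   ≡⟨ grid-pointSet S ⟩
  S                                   ∎)
  where
  open ≡-Reasoning
  open Realisation (realise m m (pointSet S) (pointSet-maximal S mS)) renaming (path to p)
  wf = proj₁ (encode-square m p (isSquarePath valid width≡ height≡))
  decode≡ = proj₂ (encode-square m p (isSquarePath valid width≡ height≡))

proposition11 : (m : ℕ) → Σ (List (Grid m)) (λ L →
                  Unique L × (∀ S → (S ∈ L) ⇔ IsMaximalAntichain S) × length L ≡ formula m)
proposition11 m =
  map (gridOf m) (codes m) ,
  map-unique (gridOf m) (λ c∈ c′∈ → gridOf-injective m (∈-codes⁻ c∈) (∈-codes⁻ c′∈)) (codes-unique m) ,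
  (λ S → mk⇔ (sound S) (complete S)) ,
  trans (length-map (gridOf m) (codes m)) (length-codes m)
  where
  sound : ∀ S → S ∈ map (gridOf m) (codes m) → IsMaximalAntichain S
  sound S S∈ with c , c∈ , refl ← ∈-map⁻ (gridOf m) S∈ = gridOf-maximal m c (∈-codes⁻ c∈)
  complete : ∀ S → IsMaximalAntichain S → S ∈ map (gridOf m) (codes m)
  complete S mS with c , wf , refl ← maximal-gridOf S mS = ∈-map⁺ (gridOf m) (∈-codes⁺ c wf)
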